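{- Let $\mathrm{DASH}$ be run on any connected graph $G$ on $n$ nodes under any sequence of adversarial single-node deletions, with weights maintained as in the context. Then for any vertex $v$, $\mathrm{rem}(v)$ is non-decreasing over any vertex deletion in which $v$ is not deleted.
   Context: Model: the network is initially a connected graph $G$ on $n$ nodes. In each round an adversary deletes one node $x$; then the healing algorithm may add edges only between former neighbors of $x$. $G$ denotes the current network, and $G'$ denotes the graph on the current nodes whose edges are exactly the healing edges added so far. $N(v,G)$, $N(v,G')$ are neighbor sets; $\delta(v)$ is the current degree of $v$ minus its initial degree. Algorithm $\mathrm{DASH}$: Initially every vertex is given an $ID$ chosen uniformly at random from $[0,1]$. When a vertex $v$ is deleted: partition the neighbors of $v$ in $G$ not having the same $ID$ as $v$ into classes according to their $ID$, and let $UN(v,G)$ contain one representative of each class (the one with lowest initial $ID$). Let $S=UN(v,G)\cup N(v,G')$. Connect the nodes of $S$ by new edges into a complete binary tree, filling positions top-down, left to right, in increasing order of $\delta$. Let $MINID$ be the minimum $ID$ in $S$; propagate it through the tree of $G'$ containing $S$, and all nodes of that tree set their $ID$ to $MINID$. (The graph $G'$ is always a forest.) Weights (for analysis): each vertex $v$ has a weight $w(v)$, initially $1$; when $v$ is deleted, $w(v)$ is added to the weight of an arbitrarily chosen neighbor of $v$ in $G'$. For a subgraph $S$, $W(S)$ is the sum of weights of its vertices. $T(x,y)$ denotes the tree (connected component) of $G'-y$ containing $x$. For a vertex $v$, $\mathrm{rem}(v)=\sum_{u\in N(v,G')}W(T(u,v))-\max_{u\in N(v,G')}W(T(u,v))+w(v)$.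 -}

module Defs where

open import Data.Nat using (ℕ; zero; suc; _+_; _∸_; _⊔_; _⊓_; _≤ᵇ_; _≡ᵇ_; ⌊_/2⌋)
open import Data.Integer using (ℤ; +_; _-_) renaming (_≤_ to _≤ℤ_)
open import Data.Bool using (Bool; true; false; _∧_; _∨_; not; if_then_else_; T)
open import Data.Fin using (Fin; _≟_)
open import Data.Maybe using (Maybe; just; nothing)
open import Data.List using (List; []; _∷_; map; foldr; filterᵇ; length; allFin; upTo)
open import Data.Nat.ListAction using (sum)
open import Data.Bool.ListAction using (any; all)
open import Data.List.Relation.Unary.Linked using (Linked)
open import Data.List.Relation.Binary.Permutation.Propositional using (_↭_)
open import Data.Product using (Σ; _×_)
open import Data.Sum using (_⊎_)
open import Relation.Nullary using (does)
open import Relation.Binary.PropositionalEquality using (_≡_)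

Graph : ℕ → Set
Graph n = Fin n → Fin n → Bool

eqF : ∀ {n} → Fin n → Fin n → Bool
eqF u v = does (u ≟ v)

count : ∀ {n} → (Fin n → Bool) → ℕ
count {n} p = length (filterᵇ p (allFin n))

Σv : ∀ {n} → (Fin n → ℕ) → ℕ
Σv {n} f = sum (map f (allFin n))

reachIn : ∀ {n} → ℕ → (Fin n → Bool) → Graph n → Fin n → Fin n → Bool
reachIn zero    ok E u z = ok u ∧ eqF u z
reachIn {n} (suc k) ok E u z =
  reachIn k ok E u z ∨ any (λ y → reachIn k ok E u y ∧ E y z ∧ ok z) (allFin n)

-- connectivity inside the vertex set ok (walks of length ≤ n suffice on n vertices)
reach : ∀ {n} → (Fin n → Bool) → Graph n → Fin n → Fin n → Bool
reach {n} = reachIn n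

record State (n : ℕ) : Set where
  field
    alive : Fin n → Bool
    heal  : Graph n        -- healing edges added so far (the graph G')
    ID    : Fin n → ℕ
    w     : Fin n → ℕ
open State public

module _ {n : ℕ} (E₀ : Graph n) where

  adjG : State n → Graph n
  adjG s u v = alive s u ∧ alive s v ∧ (E₀ u v ∨ heal s u v)

  degG : State n → Fin n → ℕ
  degG s u = count (adjG s u)

  deg₀ : Fin n → ℕ
  deg₀ u = count (E₀ u)

  δ : State n → Fin n → ℤ
  δ s u = + degG s u - + deg₀ u

adjG' : ∀ {n} → State n → Graph n
adjG' s u v = alive s u ∧ alive s v ∧ heal s u v

WT : ∀ {n} → State n → Fin n → Fin n → ℕ
WT s u v =
  Σv (λ z → if reach (λ y → alive s y ∧ not (eqF y v)) (adjG' s) u z then w s z else 0)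

rem : ∀ {n} → State n → Fin n → ℕ
rem {n} s v =
  (sum (map (λ u → WT s u v) nbrs) ∸ foldr _⊔_ 0 (map (λ u → WT s u v) nbrs)) + w s v
  where nbrs = filterᵇ (adjG' s v) (allFin n)

-- Complete binary tree on a list, filled top-down left to right:
-- the node at (0-based) position i+1 is joined to its parent at position ⌊i/2⌋.

nth : ∀ {A : Set} → List A → ℕ → Maybe A
nth []       _       = nothing
nth (a ∷ as) zero    = just a
nth (a ∷ as) (suc i) = nth as i

isF : ∀ {n} → Maybe (Fin n) → Fin n → Bool
isF nothing  _ = false
isF (just c) a = eqF c a

heapAdj : ∀ {n} → List (Fin n) → Graph n
heapAdj L a b =
  any (λ i → (isF (nth L (suc i)) a ∧ isF (nth L ⌊ i /2⌋) b)
           ∨ (isF (nth L (suc i)) b ∧ isF (nth L ⌊ i /2⌋) a))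
      (upTo (length L))

minOn : ∀ {n} → (Fin n → ℕ) → List (Fin n) → ℕ
minOn f []       = 0
minOn f (a ∷ as) = foldr (λ b m → f b ⊓ m) (f a) as

module _ {n : ℕ} (E₀ : Graph n) (id₀ : Fin n → ℕ) where

  -- UN(x,G): neighbours of x in G with ID different from x's, one per ID
  -- class, namely the one of lowest initial ID
  inUN : State n → Fin n → Fin n → Bool
  inUN s x u =
    adjG E₀ s x u ∧ not (ID s u ≡ᵇ ID s x) ∧
    all (λ u' → not (adjG E₀ s x u' ∧ (ID s u' ≡ᵇ ID s u)) ∨ (id₀ u ≤ᵇ id₀ u')) (allFin n)

  inS : State n → Fin n → Fin n → Bool
  inS s x u = inUN s x u ∨ adjG' s x u

  SList : State n → Fin n → List (Fin n)
  SList s x = filterᵇ (inS s x) (allFin n)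

  record Step (x : Fin n) (s s' : State n) : Set where
    field
      x-alive   : T (alive s x)
      order     : List (Fin n)
      order-S   : order ↭ SList s x
      order-δ   : Linked (λ a b → δ E₀ s a ≤ℤ δ E₀ s b) order
      alive-new : ∀ v → alive s' v ≡ (alive s v ∧ not (eqF v x))
      heal-new  : ∀ a b → heal s' a b ≡
                    ((heal s a b ∧ not (eqF a x) ∧ not (eqF b x)) ∨ heapAdj order a b)
      ID-new    : ∀ v → ID s' v ≡
                    (if any (λ u → reach (alive s') (adjG' s') u v) (SList s x)
                     then minOn (ID s) (SList s x) else ID s v)
      -- w(x) is added to an arbitrarily chosen neighbour of x in G'
      -- (if x has no neighbour in G', no weight is transferred)
      w-new     : (Σ (Fin n) λ y → T (adjG' s x y) ×
                      (∀ v → w s' v ≡ (if eqF v y then w s v + w s x else w s v)))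
                  ⊎ ((∀ y → adjG' s x y ≡ false) × (∀ v → w s' v ≡ w s v))

  initState : State n
  initState = record { alive = λ _ → true ; heal = λ _ _ → false ; ID = id₀ ; w = λ _ → 1 }

  data Run : State n → Set where
    start : Run initState
    step  : ∀ {s s'} (x : Fin n) → Run s → Step x s s' → Run s'

SimpleGraph : ∀ {n} → Graph n → Set
SimpleGraph {n} E = (∀ u v → E u v ≡ E v u) × (∀ v → E v v ≡ false)

Connected : ∀ {n} → Graph n → Set
Connected {n} E = ∀ u v → T (reach (λ _ → true) E u v)

-- Throughout a run the healing graph G' is a forest whose trees carry constant IDs: a round
-- joins by a binary tree vertices of S that lie in distinct trees of G' − x, because UN has one
-- vertex per ID class and none with the ID of x, whose tree holds the G'-neighbours of x.
-- In a forest the branches T(u,v) at v partition the tree C of v minus v, so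
-- rem(v) = W(C) − max_u W(T(u,v)). Deleting x moves w(x) inside C, so W(C) does not drop. The
-- vertices through which the round changes C (x and the vertices of S in C) all have the ID of v,
-- so they are a single vertex of UN or x with G'-neighbours of x, and lie in one branch at v.
-- So each new branch T′(u′,v) leaves outside itself either the whole old C or the complement
-- of some old branch, which gives
-- W(C) + W′(T′(u′,v)) ≤ W′(C′) + max_u W(T(u,v)) and thus rem(v) ≤ rem′(v).

module Submission where

open import Defs
open import Data.Bool using (Bool; true; false; _∧_; _∨_; not; if_then_else_; T)
open import Data.Bool.Properties using (∧-comm)
open import Data.Bool.ListAction using (any)
open import Data.Empty using (⊥; ⊥-elim)
open import Data.Fin using (Fin; zero; suc; _≟_)
open import Data.Fin.Properties using (all?; any?; ¬∀⟶∃¬)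
open import Data.List using (List; []; _∷_; map; foldr; filterᵇ; length; allFin; upTo; tabulate)
open import Data.List.Membership.Propositional using (_∈_; find; lose)
open import Data.List.Membership.Propositional.Properties
  using (∈-allFin; ∈-upTo⁺; ∈-upTo⁻; ∈-filter⁺; ∈-filter⁻; ∈-map⁺; ∈-map⁻)
open import Data.List.Properties using (length-tabulate; map-tabulate; length-filter)
open import Data.List.Relation.Binary.Permutation.Propositional using (↭-sym; ↭⇒↭ₛ)
open import Data.List.Relation.Binary.Permutation.Propositional.Properties using (Any-resp-↭)
import Data.List.Relation.Binary.Permutation.Setoid.Properties as Permutationₛ
import Data.List.Relation.Unary.All as All
import Data.List.Relation.Unary.All.Properties as All
open import Data.List.Relation.Unary.AllPairs using (_∷_)
open import Data.List.Relation.Unary.Any using (here; there)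
import Data.List.Relation.Unary.Any.Properties as Any
open import Data.List.Relation.Unary.Unique.Propositional using (Unique)
open import Data.List.Relation.Unary.Unique.Propositional.Properties using (filter⁺; allFin⁺)
open import Data.Maybe using (Maybe; just)
open import Data.Maybe.Properties using (just-injective)
open import Data.Nat using (ℕ; zero; suc; _+_; _∸_; _⊔_; _≤_; _<_; z≤n; s≤s; ⌊_/2⌋; _≡ᵇ_; _≤ᵇ_; _<?_)
open import Data.Nat.ListAction using (sum)
open import Data.Nat.Properties hiding (_≟_)
open import Algebra.Properties.CommutativeMonoid.Sum +-0-commutativeMonoid
  using (sum-cong-≗; sum-replicate-zero; ∑-distrib-+; ∑-comm) renaming (sum to ∑)
open import Data.Nat.Solver using (module +-*-Solver)
open import Data.Product using (Σ; _×_; _,_; proj₁; proj₂)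
open import Data.Sum using (_⊎_; inj₁; inj₂)
open import Data.Unit using (tt)
open import Function using (_∘_)
open import Relation.Binary.PropositionalEquality
open import Relation.Nullary using (¬_; Dec; yes; no)
open import Relation.Nullary.Decidable using (T?; dec-true; dec-false)

T-∧⁺ : ∀ {a b} → T a → T b → T (a ∧ b)
T-∧⁺ {true} {true} _ _ = tt

T-∧⁻ˡ : ∀ {a b} → T (a ∧ b) → T a
T-∧⁻ˡ {true} _ = tt

T-∧⁻ʳ : ∀ {a b} → T (a ∧ b) → T b
T-∧⁻ʳ {true} p = p

T-∨⁺ˡ : ∀ {a b} → T a → T (a ∨ b)
T-∨⁺ˡ {true} _ = tt

T-∨⁺ʳ : ∀ {a b} → T b → T (a ∨ b)
T-∨⁺ʳ {true} _ = tt
T-∨⁺ʳ {false} p = p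

T-∨⁻ : ∀ {a b} → T (a ∨ b) → T a ⊎ T b
T-∨⁻ {true} _ = inj₁ tt
T-∨⁻ {false} p = inj₂ p

T-not⁺ : ∀ {a} → ¬ T a → T (not a)
T-not⁺ {true} p = p tt
T-not⁺ {false} _ = tt

T-not⁻ : ∀ {a} → T (not a) → ¬ T a
T-not⁻ {true} () 
T-not⁻ {false} _ ()

T⇒≡true : ∀ {a} → T a → a ≡ true
T⇒≡true {true} _ = refl

¬T⇒≡false : ∀ {a} → ¬ T a → a ≡ false
¬T⇒≡false {true} p = ⊥-elim (p tt)
¬T⇒≡false {false} _ = refl

T⇔T⇒≡ : ∀ {a b} → (T a → T b) → (T b → T a) → a ≡ b
T⇔T⇒≡ {true} {true} _ _ = refl
T⇔T⇒≡ {true} {false} f _ = ⊥-elim (f tt)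
T⇔T⇒≡ {false} {true} _ g = ⊥-elim (g tt)
T⇔T⇒≡ {false} {false} _ _ = refl

eqF⇒≡ : ∀ {n} {u v : Fin n} → T (eqF u v) → u ≡ v
eqF⇒≡ {u = u} {v} p with u ≟ v
... | yes u≡v = u≡v

eqF-refl : ∀ {n} (u : Fin n) → T (eqF u u)
eqF-refl u = subst T (sym (dec-true (u ≟ u) refl)) tt

≢⇒eqF≡false : ∀ {n} {u v : Fin n} → u ≢ v → eqF u v ≡ false
≢⇒eqF≡false {u = u} {v} = dec-false (u ≟ v)

any⁻ : ∀ {A : Set} (p : A → Bool) (l : List A) → T (any p l) → Σ A λ y → y ∈ l × T (p y)
any⁻ p l h = find (Any.any⁻ p l h)

any⁺ : ∀ {A : Set} (p : A → Bool) {l : List A} {y : A} → y ∈ l → T (p y) → T (any p l)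
any⁺ p y∈l py = Any.any⁺ p (lose y∈l py)

any-cong : ∀ {A : Set} {p q : A → Bool} → (∀ y → p y ≡ q y) → (l : List A) → any p l ≡ any q l
any-cong e [] = refl
any-cong e (a ∷ l) = cong₂ _∨_ (e a) (any-cong e l)

Symmetric : ∀ {n} → Graph n → Set
Symmetric {n} E = ∀ (a b : Fin n) → T (E a b) → T (E b a)

data Path {n} (ok : Fin n → Bool) (E : Graph n) (u : Fin n) : Fin n → Set where
  here : T (ok u) → Path ok E u u
  step : ∀ {y z} → Path ok E u y → T (E y z) → T (ok z) → Path ok E u z

module _ {n : ℕ} {ok : Fin n → Bool} {E : Graph n} where

  target-ok : ∀ {u z} → Path ok E u z → T (ok z)
  target-ok (here o) = o
  target-ok (step _ _ o) = o

  source-ok : ∀ {u z} → Path ok E u z → T (ok u)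
  source-ok (here o) = o
  source-ok (step p _ _) = source-ok p

  path-trans : ∀ {u y z} → Path ok E u y → Path ok E y z → Path ok E u z
  path-trans p (here _) = p
  path-trans p (step q e o) = step (path-trans p q) e o

  path-edge : ∀ {u z} → T (ok u) → T (E u z) → T (ok z) → Path ok E u z
  path-edge ou e oz = step (here ou) e oz

  path-cons : ∀ {u y z} → T (ok u) → T (E u y) → Path ok E y z → Path ok E u z
  path-cons ou e q = path-trans (path-edge ou e (source-ok q)) q

  path-sym : Symmetric E → ∀ {u z} → Path ok E u z → Path ok E z u
  path-sym E-sym (here o) = here o
  path-sym E-sym (step p e o) = path-cons o (E-sym _ _ e) (path-sym E-sym p)

path-map : ∀ {n} {ok ok′ : Fin n → Bool} {E E′ : Graph n} →
           (∀ z → T (ok z) → T (ok′ z)) → (∀ a b → T (E a b) → T (E′ a b)) →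
           ∀ {u z} → Path ok E u z → Path ok′ E′ u z
path-map ok⊆ok′ E⊆E′ (here o) = here (ok⊆ok′ _ o)
path-map ok⊆ok′ E⊆E′ (step p e o) = step (path-map ok⊆ok′ E⊆E′ p) (E⊆E′ _ _ e) (ok⊆ok′ _ o)

last-edge : ∀ {n} {ok : Fin n → Bool} {E : Graph n} {a z} → Path ok E a z → a ≢ z → Σ (Fin n) λ y → T (E y z)
last-edge (here _) a≢a = ⊥-elim (a≢a refl)
last-edge (step {y} _ e _) _ = y , e

module _ {A : Set} where

  length-filterᵇ-mono : (p q : A → Bool) → (∀ z → T (p z) → T (q z)) → (l : List A) →
                        length (filterᵇ p l) ≤ length (filterᵇ q l)
  length-filterᵇ-mono p q p⇒q [] = z≤n
  length-filterᵇ-mono p q p⇒q (a ∷ l) with p a in pa | q a in qa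
  ... | true  | true  = s≤s (length-filterᵇ-mono p q p⇒q l)
  ... | true  | false = ⊥-elim (subst T qa (p⇒q a (subst T (sym pa) tt)))
  ... | false | true  = m≤n⇒m≤1+n (length-filterᵇ-mono p q p⇒q l)
  ... | false | false = length-filterᵇ-mono p q p⇒q l

  length-filterᵇ-< : (p q : A → Bool) → (∀ z → T (p z) → T (q z)) → ∀ {z} {l : List A} → z ∈ l →
                     T (q z) → ¬ T (p z) → length (filterᵇ p l) < length (filterᵇ q l)
  length-filterᵇ-< p q p⇒q {l = a ∷ l} (here refl) qz ¬pz with p a | q a
  ... | true  | _     = ⊥-elim (¬pz tt)
  ... | false | false = ⊥-elim qz
  ... | false | true  = s≤s (length-filterᵇ-mono p q p⇒q l)
  length-filterᵇ-< p q p⇒q {l = a ∷ l} (there z∈l) qz ¬pz with p a in pa | q a in qa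
  ... | true  | true  = s≤s (length-filterᵇ-< p q p⇒q z∈l qz ¬pz)
  ... | true  | false = ⊥-elim (subst T qa (p⇒q a (subst T (sym pa) tt)))
  ... | false | true  = m≤n⇒m≤1+n (length-filterᵇ-< p q p⇒q z∈l qz ¬pz)
  ... | false | false = length-filterᵇ-< p q p⇒q z∈l qz ¬pz

count≤n : ∀ {n} (p : Fin n → Bool) → count p ≤ n
count≤n {n} p = subst (count p ≤_) (length-tabulate {n = n} (λ i → i)) (length-filter (T? ∘ p) (allFin n))

module _ {n : ℕ} (ok : Fin n → Bool) (E : Graph n) (u : Fin n) where

  reachIn⇒Path : ∀ k z → T (reachIn k ok E u z) → Path ok E u z
  reachIn⇒Path zero z h = subst (Path ok E u) (eqF⇒≡ {u = u} {z} (T-∧⁻ʳ {ok u} h)) (here (T-∧⁻ˡ h))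
  reachIn⇒Path (suc k) z h with T-∨⁻ {reachIn k ok E u z} h
  ... | inj₁ h′ = reachIn⇒Path k z h′
  ... | inj₂ h′ with any⁻ (λ y → reachIn k ok E u y ∧ E y z ∧ ok z) (allFin n) h′
  ... | y , _ , r = step (reachIn⇒Path k y (T-∧⁻ˡ r)) (T-∧⁻ˡ (T-∧⁻ʳ {reachIn k ok E u y} r))
                         (T-∧⁻ʳ (T-∧⁻ʳ {reachIn k ok E u y} r))

  Path⇒reachIn : ∀ {z} → Path ok E u z → Σ ℕ λ k → T (reachIn k ok E u z)
  Path⇒reachIn (here o) = 0 , T-∧⁺ o (eqF-refl u)
  Path⇒reachIn {z} (step {y} p e o) with Path⇒reachIn p
  ... | k , h = suc k , T-∨⁺ʳ {reachIn k ok E u z}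
                          (any⁺ (λ y → reachIn k ok E u y ∧ E y z ∧ ok z) (∈-allFin y) (T-∧⁺ h (T-∧⁺ e o)))

  reachIn-suc : ∀ k z → T (reachIn k ok E u z) → T (reachIn (suc k) ok E u z)
  reachIn-suc k z = T-∨⁺ˡ

  reachIn-mono : ∀ {k m} → k ≤ m → ∀ z → T (reachIn k ok E u z) → T (reachIn m ok E u z)
  reachIn-mono {k} {m} k≤m z h = subst (λ m → T (reachIn m ok E u z)) (m∸n+n≡m k≤m) (go (m ∸ k))
    where
    go : ∀ d → T (reachIn (d + k) ok E u z)
    go zero    = h
    go (suc d) = reachIn-suc (d + k) z (go d)

  Saturated : ℕ → Set
  Saturated k = ∀ z → reachIn (suc k) ok E u z ≡ reachIn k ok E u z

  saturated-suc : ∀ {k} → Saturated k → Saturated (suc k)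
  saturated-suc sat z =
    cong₂ _∨_ (sat z) (any-cong (λ y → cong (_∧ (E y z ∧ ok z)) (sat y)) (allFin n))

  saturated-+ : ∀ {j} → Saturated j → ∀ d z → reachIn (d + j) ok E u z ≡ reachIn j ok E u z
  saturated-+ sat zero    z = refl
  saturated-+ {j} sat (suc d) z = trans (sat-+ d z) (saturated-+ sat d z)
    where
    sat-+ : ∀ d → Saturated (d + j)
    sat-+ zero    = sat
    sat-+ (suc d) = saturated-suc {d + j} (sat-+ d)

  saturated-or-growing : ∀ k → (Σ ℕ λ j → j < k × Saturated j) ⊎ (k ≤ count (reachIn k ok E u))
  saturated-or-growing zero = inj₂ z≤n
  saturated-or-growing (suc k) with saturated-or-growing k
  ... | inj₁ (j , j<k , sat) = inj₁ (j , m<n⇒m<1+n j<k , sat)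
  ... | inj₂ k≤count with all? (λ z → T? (not (reachIn (suc k) ok E u z) ∨ reachIn k ok E u z))
  ... | yes shrinks = inj₁ (k , ≤-refl , λ z → T⇔T⇒≡ (back z (shrinks z)) (reachIn-suc k z))
    where
    back : ∀ z → T (not (reachIn (suc k) ok E u z) ∨ reachIn k ok E u z) →
           T (reachIn (suc k) ok E u z) → T (reachIn k ok E u z)
    back z h r with T-∨⁻ {not (reachIn (suc k) ok E u z)} h
    ... | inj₁ ¬r = ⊥-elim (T-not⁻ ¬r r)
    ... | inj₂ r′ = r′
  ... | no ¬shrinks with ¬∀⟶∃¬ n _ (λ z → T? (not (reachIn (suc k) ok E u z) ∨ reachIn k ok E u z)) ¬shrinks
  ... | z , new = inj₂ (≤-trans (s≤s k≤count)
          (length-filterᵇ-< (reachIn k ok E u) (reachIn (suc k) ok E u) (reachIn-suc k) (∈-allFin z) now before))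
    where
    now : T (reachIn (suc k) ok E u z)
    now with reachIn (suc k) ok E u z
    ... | true  = tt
    ... | false = new tt
    before : ¬ T (reachIn k ok E u z)
    before r = new (T-∨⁺ʳ {not (reachIn (suc k) ok E u z)} r)

  -- The sets reachIn k grow strictly until they saturate, and a subset of Fin n grows at most n times.
  saturated-≤n : Σ ℕ λ j → j ≤ n × Saturated j
  saturated-≤n with saturated-or-growing (suc n)
  ... | inj₁ (j , s≤s j≤n , sat) = j , j≤n , sat
  ... | inj₂ grows = ⊥-elim (<-irrefl refl (≤-trans grows (count≤n (reachIn (suc n) ok E u))))

  reachIn⇒reach : ∀ m z → T (reachIn m ok E u z) → T (reach ok E u z)
  reachIn⇒reach m z h with m ≤? n
  ... | yes m≤n = reachIn-mono m≤n z h
  ... | no m≰n with saturated-≤n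
  ... | j , j≤n , sat = reachIn-mono j≤n z (subst T (trans (cong (λ m → reachIn m ok E u z) (sym j+d≡m))
                                                              (saturated-+ sat (m ∸ j) z)) h)
    where
    j+d≡m : m ∸ j + j ≡ m
    j+d≡m = m∸n+n≡m (≤-trans j≤n (<⇒≤ (≰⇒> m≰n)))

reach⇒Path : ∀ {n} {ok : Fin n → Bool} {E : Graph n} {u z} → T (reach ok E u z) → Path ok E u z
reach⇒Path {n} {ok} {E} {u} {z} = reachIn⇒Path ok E u n z

Path⇒reach : ∀ {n} {ok : Fin n → Bool} {E : Graph n} {u z} → Path ok E u z → T (reach ok E u z)
Path⇒reach {ok = ok} {E} {u} {z} p with Path⇒reachIn ok E u p
... | k , h = reachIn⇒reach ok E u k z h

if-true : ∀ (c : ℕ) {b} → T b → (if b then c else 0) ≡ c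
if-true c {true} _ = refl

if-false : ∀ (c : ℕ) {b} → b ≡ false → (if b then c else 0) ≡ 0
if-false c refl = refl

if-∧ : ∀ (a b : Bool) (c : ℕ) → (if a then (if b then c else 0) else 0) ≡ (if a ∧ b then c else 0)
if-∧ true b c = refl
if-∧ false b c = refl

if-+ : ∀ (b : Bool) (c d : ℕ) → (if b then c + d else 0) ≡ (if b then c else 0) + (if b then d else 0)
if-+ true c d = refl
if-+ false c d = refl

if-mono : ∀ {a b : Bool} (c : ℕ) → (T a → T b) → (if a then c else 0) ≤ (if b then c else 0)
if-mono {true} {true} c f = ≤-refl
if-mono {true} {false} c f = ⊥-elim (f tt)
if-mono {false} c f = z≤n

Σv≡∑ : ∀ {n} (f : Fin n → ℕ) → Σv f ≡ ∑ f
Σv≡∑ f = trans (cong sum (map-tabulate (λ i → i) f)) (sum-tabulate f)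
  where
  sum-tabulate : ∀ {n} (f : Fin n → ℕ) → sum (tabulate f) ≡ ∑ f
  sum-tabulate {zero}  f = refl
  sum-tabulate {suc n} f = cong (f zero +_) (sum-tabulate (f ∘ suc))

∑-mono : ∀ {n} {f g : Fin n → ℕ} → (∀ i → f i ≤ g i) → ∑ f ≤ ∑ g
∑-mono {zero}  f≤g = z≤n
∑-mono {suc n} f≤g = +-mono-≤ (f≤g zero) (∑-mono (f≤g ∘ suc))

∑-zero : ∀ {n} {f : Fin n → ℕ} → (∀ i → f i ≡ 0) → ∑ f ≡ 0
∑-zero {n} f≡0 = trans (sum-cong-≗ f≡0) (sum-replicate-zero n)

∑-indicator : ∀ {n} (y : Fin n) (c : ℕ) → ∑ (λ i → if eqF i y then c else 0) ≡ c
∑-indicator {suc n} zero c =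
  trans (cong₂ _+_ (if-true c (eqF-refl {suc n} zero))
                   (∑-zero {n} {λ i → if eqF (suc i) zero then c else 0}
                           (λ i → if-false c (≢⇒eqF≡false {u = suc i} {zero} (λ ())))))
        (+-identityʳ c)
∑-indicator {suc n} (suc y) c =
  trans (cong (_+ ∑ (λ i → if eqF i y then c else 0)) (if-false c (≢⇒eqF≡false {u = zero} {suc y} (λ ()))))
        (∑-indicator y c)

∑-split : ∀ {n} (f : Fin n → ℕ) (x : Fin n) → ∑ f ≡ ∑ (λ z → if eqF z x then 0 else f z) + f x
∑-split f x = trans (sum-cong-≗ split)
                    (trans (∑-distrib-+ (λ z → if eqF z x then 0 else f z) (λ z → if eqF z x then f x else 0))
                           (cong (∑ (λ z → if eqF z x then 0 else f z) +_) (∑-indicator x (f x))))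
  where
  split : ∀ z → f z ≡ (if eqF z x then 0 else f z) + (if eqF z x then f x else 0)
  split z with z ≟ x
  ... | yes refl = refl
  ... | no _     = sym (+-identityʳ _)

if-∑ : ∀ {n} (b : Bool) (f : Fin n → ℕ) → (if b then ∑ f else 0) ≡ ∑ (λ z → if b then f z else 0)
if-∑ true  f = refl
if-∑ {n} false f = sym (∑-zero {n} (λ _ → refl))

sum-filterᵇ : ∀ {A : Set} (p : A → Bool) (g : A → ℕ) (l : List A) →
              sum (map g (filterᵇ p l)) ≡ sum (map (λ u → if p u then g u else 0) l)
sum-filterᵇ p g [] = refl
sum-filterᵇ p g (a ∷ l) with p a
... | true  = cong (g a +_) (sum-filterᵇ p g l)
... | false = sum-filterᵇ p g l

maximum : List ℕ → ℕ
maximum = foldr _⊔_ 0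

maximum-≥ : ∀ {y} {l : List ℕ} → y ∈ l → y ≤ maximum l
maximum-≥ {l = a ∷ l} (here refl) = m≤m⊔n a (maximum l)
maximum-≥ {l = a ∷ l} (there y∈l) = ≤-trans (maximum-≥ y∈l) (m≤n⊔m a (maximum l))

maximum-≤-sum : ∀ (l : List ℕ) → maximum l ≤ sum l
maximum-≤-sum [] = z≤n
maximum-≤-sum (a ∷ l) = ⊔-lub (m≤m+n a (sum l)) (≤-trans (maximum-≤-sum l) (m≤n+m (sum l) a))

+-maximum-≤ : ∀ (c d : ℕ) (l : List ℕ) → (∀ {y} → y ∈ l → c + y ≤ d) → c ≤ d → c + maximum l ≤ d
+-maximum-≤ c d [] bound c≤d = subst (_≤ d) (sym (+-identityʳ c)) c≤d
+-maximum-≤ c d (a ∷ l) bound c≤d =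
  subst (_≤ d) (sym (+-distribˡ-⊔ c a (maximum l)))
        (⊔-lub (bound (here refl)) (+-maximum-≤ c d l (bound ∘ there) c≤d))

without : ∀ {n} → (Fin n → Bool) → Fin n → Fin n → Bool
without ok v y = ok y ∧ not (eqF y v)

without⁺ : ∀ {n} {ok : Fin n → Bool} {v y} → T (ok y) → y ≢ v → T (without ok v y)
without⁺ o y≢v = T-∧⁺ o (T-not⁺ (λ y≡v → y≢v (eqF⇒≡ y≡v)))

without-ok : ∀ {n} {ok : Fin n → Bool} {v y} → T (without ok v y) → T (ok y)
without-ok h = T-∧⁻ˡ h

without-≢ : ∀ {n} {ok : Fin n → Bool} {v y} → T (without ok v y) → y ≢ v
without-≢ {ok = ok} {v} {y} h refl = T-not⁻ (T-∧⁻ʳ {ok y} h) (eqF-refl y)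

EdgesWithin : ∀ {n} → (Fin n → Bool) → Graph n → Set
EdgesWithin {n} ok E = ∀ (a b : Fin n) → T (E a b) → T (ok a) × T (ok b)

-- Acyclicity in the local form the proofs use: two distinct neighbours of v are never joined
-- by a path avoiding v.
Forest : ∀ {n} → (Fin n → Bool) → Graph n → Set
Forest {n} ok E = ∀ (v u₁ u₂ : Fin n) → T (E v u₁) → T (E v u₂) → u₁ ≢ u₂ → ¬ Path (without ok v) E u₁ u₂

forest-⊆ : ∀ {n} {ok : Fin n → Bool} {E E₂ : Graph n} → Forest ok E → (∀ a b → T (E₂ a b) → T (E a b)) →
           Forest ok E₂
forest-⊆ forest E₂⊆E v u₁ u₂ e₁ e₂ u₁≢u₂ P =
  forest v u₁ u₂ (E₂⊆E _ _ e₁) (E₂⊆E _ _ e₂) u₁≢u₂ (path-map (λ _ o → o) E₂⊆E P)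

PathToSet : ∀ {n} → (Fin n → Bool) → Graph n → (Fin n → Bool) → Fin n → Set
PathToSet {n} ok E A z = Σ (Fin n) λ a → T (A a) × Path ok E z a

path-unwithout : ∀ {n} {ok : Fin n → Bool} {E : Graph n} {v p q} → Path (without ok v) E p q → Path ok E p q
path-unwithout {ok = ok} {v = v} = path-map (λ z → without-ok {ok = ok} {v} {z}) (λ _ _ e → e)

path-split : ∀ {n} {ok : Fin n → Bool} {E E₂ : Graph n} (A : Fin n → Bool) → Symmetric E →
             (∀ a b → T (ok a) → T (ok b) → T (E₂ a b) → T (E a b) ⊎ (T (A a) × T (A b))) →
             ∀ {p q} → Path ok E₂ p q → Path ok E p q ⊎ (PathToSet ok E A p × PathToSet ok E A q)
path-split A E-sym split (here o) = inj₁ (here o)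
path-split A E-sym split (step {y} {z} P e o) with path-split A E-sym split P | split y z (target-ok P) o e
... | inj₁ P′ | inj₁ e′ = inj₁ (step P′ e′ o)
... | inj₁ P′ | inj₂ (y∈A , z∈A) = inj₂ ((y , y∈A , P′) , (z , z∈A , here o))
... | inj₂ (p⇝A , (a , a∈A , y⇝a)) | inj₁ e′ = inj₂ (p⇝A , (a , a∈A , path-cons o (E-sym y z e′) y⇝a))
... | inj₂ (p⇝A , _) | inj₂ (_ , z∈A) = inj₂ (p⇝A , (z , z∈A , here o))

module _ {n : ℕ} {ok : Fin n → Bool} {E E₂ : Graph n} {a b : Fin n}
         (E-sym : Symmetric E) (E₂-sym : Symmetric E₂) (E-within : EdgesWithin ok E) (forest : Forest ok E)
         (a-ok : T (ok a)) (¬a⇝b : ¬ Path ok E a b)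
         (E₂-edge : ∀ p q → T (E₂ p q) → T (E p q) ⊎ ((p ≡ a × q ≡ b) ⊎ (p ≡ b × q ≡ a))) where

  private
    Ends : Fin n → Bool
    Ends z = eqF z a ∨ eqF z b

    Ends⁻ : ∀ {z} → T (Ends z) → z ≡ a ⊎ z ≡ b
    Ends⁻ {z} h with T-∨⁻ {eqF z a} h
    ... | inj₁ z≡a = inj₁ (eqF⇒≡ z≡a)
    ... | inj₂ z≡b = inj₂ (eqF⇒≡ z≡b)

    ¬b⇝a : ¬ Path ok E b a
    ¬b⇝a P = ¬a⇝b (path-sym E-sym P)

    a≢b : a ≢ b
    a≢b refl = ¬a⇝b (here a-ok)

    NewEdge : Fin n → Fin n → Set
    NewEdge p q = (p ≡ a × q ≡ b) ⊎ (p ≡ b × q ≡ a)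

    split : ∀ v p q → T (without ok v p) → T (without ok v q) → T (E₂ p q) → T (E p q) ⊎ (T (Ends p) × T (Ends q))
    split v p q _ _ e with E₂-edge p q e
    ... | inj₁ e′ = inj₁ e′
    ... | inj₂ (inj₁ (refl , refl)) = inj₂ (T-∨⁺ˡ (eqF-refl a) , T-∨⁺ʳ {eqF b a} (eqF-refl b))
    ... | inj₂ (inj₂ (refl , refl)) = inj₂ (T-∨⁺ʳ {eqF b a} (eqF-refl b) , T-∨⁺ˡ (eqF-refl a))

    new-edge-ends-disconnected : ∀ {v u} → NewEdge v u → ¬ Path ok E u v
    new-edge-ends-disconnected (inj₁ (refl , refl)) = ¬b⇝a
    new-edge-ends-disconnected (inj₂ (refl , refl)) = ¬a⇝b

    other-end : ∀ {v u d} → NewEdge v u → T (Ends d) → d ≢ v → d ≡ u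
    other-end {d = d} (inj₁ (refl , refl)) d∈ends d≢v with Ends⁻ {d} d∈ends
    ... | inj₁ refl = ⊥-elim (d≢v refl)
    ... | inj₂ refl = refl
    other-end {d = d} (inj₂ (refl , refl)) d∈ends d≢v with Ends⁻ {d} d∈ends
    ... | inj₁ refl = refl
    ... | inj₂ refl = ⊥-elim (d≢v refl)

    no-cycle-through-new-edge : ∀ v u₁ u₂ → NewEdge v u₁ → T (E₂ v u₂) → u₁ ≢ u₂ →
                                ¬ Path (without ok v) E₂ u₁ u₂
    no-cycle-through-new-edge v u₁ u₂ new e₂ u₁≢u₂ P with E₂-edge v u₂ e₂
    no-cycle-through-new-edge v u₁ u₂ (inj₁ (refl , refl)) e₂ u₁≢u₂ P | inj₂ (inj₁ (_ , refl)) = u₁≢u₂ refl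
    no-cycle-through-new-edge v u₁ u₂ (inj₁ (refl , refl)) e₂ u₁≢u₂ P | inj₂ (inj₂ (a≡b , _)) = a≢b a≡b
    no-cycle-through-new-edge v u₁ u₂ (inj₂ (refl , refl)) e₂ u₁≢u₂ P | inj₂ (inj₁ (b≡a , _)) = a≢b (sym b≡a)
    no-cycle-through-new-edge v u₁ u₂ (inj₂ (refl , refl)) e₂ u₁≢u₂ P | inj₂ (inj₂ (_ , refl)) = u₁≢u₂ refl
    no-cycle-through-new-edge v u₁ u₂ new e₂ u₁≢u₂ P | inj₁ e with path-split Ends E-sym (split v) P
    ... | inj₁ P′ = new-edge-ends-disconnected new (step (path-unwithout P′) (E-sym v u₂ e) (proj₁ (E-within v u₂ e)))
    ... | inj₂ (_ , (d , d∈ends , u₂⇝d)) with other-end new d∈ends (without-≢ {ok = ok} (target-ok u₂⇝d))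
    ... | refl = new-edge-ends-disconnected new
                   (step (path-sym E-sym (path-unwithout u₂⇝d)) (E-sym v u₂ e) (proj₁ (E-within v u₂ e)))

  forest-add-edge : Forest ok E₂
  forest-add-edge v u₁ u₂ e₁ e₂ u₁≢u₂ P with E₂-edge v u₁ e₁
  ... | inj₂ new = no-cycle-through-new-edge v u₁ u₂ new e₂ u₁≢u₂ P
  ... | inj₁ e₁′ with E₂-edge v u₂ e₂
  ... | inj₂ new = no-cycle-through-new-edge v u₂ u₁ new e₁ (λ q → u₁≢u₂ (sym q)) (path-sym E₂-sym P)
  ... | inj₁ e₂′ with path-split Ends E-sym (split v) P
  ... | inj₁ P′ = forest v u₁ u₂ e₁′ e₂′ u₁≢u₂ P′
  ... | inj₂ ((c , c∈ends , u₁⇝c) , (d , d∈ends , u₂⇝d)) with c ≟ d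
  ... | yes refl = forest v u₁ u₂ e₁′ e₂′ u₁≢u₂ (path-trans u₁⇝c (path-sym E-sym u₂⇝d))
  ... | no c≢d = ends-joined (Ends⁻ {c} c∈ends) (Ends⁻ {d} d∈ends)
    where
    c⇝d : Path ok E c d
    c⇝d = path-trans (path-sym E-sym (path-unwithout u₁⇝c))
            (path-cons (proj₂ (E-within v u₁ e₁′)) (E-sym v u₁ e₁′)
              (path-cons (proj₁ (E-within v u₁ e₁′)) e₂′ (path-unwithout u₂⇝d)))
    ends-joined : c ≡ a ⊎ c ≡ b → d ≡ a ⊎ d ≡ b → ⊥
    ends-joined (inj₁ refl) (inj₁ refl) = c≢d refl
    ends-joined (inj₁ refl) (inj₂ refl) = ¬a⇝b c⇝d
    ends-joined (inj₂ refl) (inj₁ refl) = ¬b⇝a c⇝d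
    ends-joined (inj₂ refl) (inj₂ refl) = c≢d refl

module _ {n : ℕ} (ok : Fin n → Bool) (E : Graph n) (w : Fin n → ℕ) where

  branchWeight : Fin n → Fin n → ℕ
  branchWeight v u = Σv (λ z → if reach (without ok v) E u z then w z else 0)

  componentWeight : Fin n → ℕ
  componentWeight v = Σv (λ z → if reach ok E v z then w z else 0)

  restWeight : Fin n → Fin n → ℕ
  restWeight v u = Σv (λ z → if reach ok E v z ∧ not (reach (without ok v) E u z) then w z else 0)

  path-enters-branch : ∀ {v z} → z ≢ v → Path ok E v z → Σ (Fin n) λ u → T (E v u) × Path (without ok v) E u z
  path-enters-branch z≢v (here o) = ⊥-elim (z≢v refl)
  path-enters-branch {v} {z} z≢v (step {y} P e o) with y ≟ v
  ... | yes refl = z , e , here (without⁺ {ok = ok} o z≢v)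
  ... | no y≢v with path-enters-branch y≢v P
  ... | u , v-u , u⇝y = u , v-u , step u⇝y e (without⁺ {ok = ok} o z≢v)

  branch⇒path : ∀ {v u z} → T (ok v) → T (E v u) → Path (without ok v) E u z → Path ok E v z
  branch⇒path {v} v-ok e P = path-cons v-ok e (path-unwithout {ok = ok} {v = v} P)

  branch-unique : Forest ok E → Symmetric E → ∀ {v u₁ u₂ z} → T (E v u₁) → T (E v u₂) →
                  Path (without ok v) E u₁ z → Path (without ok v) E u₂ z → u₁ ≡ u₂
  branch-unique forest E-sym {v} {u₁} {u₂} e₁ e₂ P₁ P₂ with u₁ ≟ u₂
  ... | yes u₁≡u₂ = u₁≡u₂
  ... | no u₁≢u₂ = ⊥-elim (forest v u₁ u₂ e₁ e₂ u₁≢u₂ (path-trans P₁ (path-sym E-sym P₂)))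

  branch-indicators-sum : Symmetric E → Forest ok E → ∀ {v} → T (ok v) → ∀ z →
    ∑ (λ u → if E v u ∧ reach (without ok v) E u z then w z else 0) + (if eqF z v then w v else 0)
    ≡ (if reach ok E v z then w z else 0)
  branch-indicators-sum E-sym forest {v} v-ok z with z ≟ v
  ... | yes refl = begin
      ∑ (λ u → if E v u ∧ reach (without ok v) E u v then w v else 0) + w v
        ≡⟨ cong (_+ w v) (∑-zero {n} (λ u → if-false (w v) (¬T⇒≡false (no-branch-contains-v u)))) ⟩
      w v
        ≡⟨ sym (if-true (w v) (Path⇒reach {ok = ok} {E} {v} {v} (here v-ok))) ⟩
      (if reach ok E v v then w v else 0) ∎
    where
    open ≡-Reasoning
    no-branch-contains-v : ∀ u → ¬ T (E v u ∧ reach (without ok v) E u v)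
    no-branch-contains-v u h = without-≢ {ok = ok} (target-ok (reach⇒Path {ok = without ok v} {E} {u} {v} (T-∧⁻ʳ {E v u} h))) refl
  ... | no z≢v with T? (reach ok E v z)
  ... | no z∉C = trans (cong (_+ 0) (∑-zero {n} (λ u → if-false (w z) (¬T⇒≡false (not-in-branch u)))))
                       (sym (if-false (w z) (¬T⇒≡false z∉C)))
    where
    not-in-branch : ∀ u → ¬ T (E v u ∧ reach (without ok v) E u z)
    not-in-branch u h = z∉C (Path⇒reach (branch⇒path v-ok (T-∧⁻ˡ h) (reach⇒Path (T-∧⁻ʳ {E v u} h))))
  ... | yes z∈C with path-enters-branch z≢v (reach⇒Path z∈C)
  ... | u₀ , v-u₀ , u₀⇝z = begin
      ∑ (λ u → if E v u ∧ reach (without ok v) E u z then w z else 0) + 0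
        ≡⟨ +-identityʳ _ ⟩
      ∑ (λ u → if E v u ∧ reach (without ok v) E u z then w z else 0)
        ≡⟨ sum-cong-≗ (λ u → cong (λ b → if b then w z else 0) (T⇔T⇒≡ (only-u₀ u) (u₀-only u))) ⟩
      ∑ (λ u → if eqF u u₀ then w z else 0)
        ≡⟨ ∑-indicator u₀ (w z) ⟩
      w z
        ≡⟨ sym (if-true (w z) z∈C) ⟩
      (if reach ok E v z then w z else 0) ∎
    where
    open ≡-Reasoning
    only-u₀ : ∀ u → T (E v u ∧ reach (without ok v) E u z) → T (eqF u u₀)
    only-u₀ u h = subst (λ t → T (eqF u t))
                        (branch-unique forest E-sym (T-∧⁻ˡ h) v-u₀ (reach⇒Path (T-∧⁻ʳ {E v u} h)) u₀⇝z) (eqF-refl u)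
    u₀-only : ∀ u → T (eqF u u₀) → T (E v u ∧ reach (without ok v) E u z)
    u₀-only u h with eqF⇒≡ {u = u} {u₀} h
    ... | refl = T-∧⁺ v-u₀ (Path⇒reach u₀⇝z)

  branch-weights-sum : Symmetric E → Forest ok E → ∀ {v} → T (ok v) →
                       sum (map (branchWeight v) (filterᵇ (E v) (allFin n))) + w v ≡ componentWeight v
  branch-weights-sum E-sym forest {v} v-ok = begin
      sum (map (branchWeight v) (filterᵇ (E v) (allFin n))) + w v
        ≡⟨ cong₂ _+_ (trans (sum-filterᵇ (E v) (branchWeight v) (allFin n)) (Σv≡∑ (λ u → if E v u then branchWeight v u else 0))) (sym (∑-indicator v (w v))) ⟩
      ∑ (λ u → if E v u then branchWeight v u else 0) + ∑ at-v
        ≡⟨ cong (_+ ∑ at-v) (sum-cong-≗ (λ u → trans (cong (λ t → if E v u then t else 0) (Σv≡∑ (z∈T u)))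
                                                      (if-∑ (E v u) (z∈T u)))) ⟩
      ∑ (λ u → ∑ (λ z → in-branch u z)) + ∑ at-v
        ≡⟨ cong (_+ ∑ at-v) (∑-comm in-branch) ⟩
      ∑ (λ z → ∑ (λ u → in-branch u z)) + ∑ at-v
        ≡⟨ sym (∑-distrib-+ (λ z → ∑ (λ u → in-branch u z)) at-v) ⟩
      ∑ (λ z → ∑ (λ u → in-branch u z) + at-v z)
        ≡⟨ sum-cong-≗ (λ z → trans (cong (_+ at-v z) (sum-cong-≗ (λ u → if-∧ (E v u) (reach (without ok v) E u z) (w z))))
                                   (branch-indicators-sum E-sym forest v-ok z)) ⟩
      ∑ (λ z → if reach ok E v z then w z else 0)
        ≡⟨ sym (Σv≡∑ (λ z → if reach ok E v z then w z else 0)) ⟩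
      componentWeight v ∎
    where
    open ≡-Reasoning
    z∈T : Fin n → Fin n → ℕ
    z∈T u z = if reach (without ok v) E u z then w z else 0
    in-branch : Fin n → Fin n → ℕ
    in-branch u z = if E v u then z∈T u z else 0
    at-v : Fin n → ℕ
    at-v z = if eqF z v then w v else 0

  component-split : ∀ {v u} → T (ok v) → T (E v u) → componentWeight v ≡ branchWeight v u + restWeight v u
  component-split {v} {u} v-ok v-u =
    trans (Σv≡∑ in-C) (trans (sum-cong-≗ pointwise)
      (trans (∑-distrib-+ in-T in-C∖T) (sym (cong₂ _+_ (Σv≡∑ in-T) (Σv≡∑ in-C∖T)))))
    where
    in-C in-T in-C∖T : Fin n → ℕ
    in-C z = if reach ok E v z then w z else 0
    in-T z = if reach (without ok v) E u z then w z else 0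
    in-C∖T z = if reach ok E v z ∧ not (reach (without ok v) E u z) then w z else 0
    pointwise : ∀ z → in-C z ≡ in-T z + in-C∖T z
    pointwise z with reach (without ok v) E u z in z∈T | reach ok E v z in z∈C
    ... | true  | true  = sym (+-identityʳ (w z))
    ... | true  | false = ⊥-elim (subst T z∈C (Path⇒reach (branch⇒path v-ok v-u (reach⇒Path (subst T (sym z∈T) tt)))))
    ... | false | true  = refl
    ... | false | false = refl

-- The weight of x either moves to some y ≠ x or (when x has no neighbour in G') is dropped,
-- as in the field w-new of Step.
weight-transfer-≤ : ∀ {n} (P Q : Fin n → Bool) (w w′ : Fin n → ℕ) (x : Fin n) →
  (∀ z → z ≢ x → T (P z) → T (Q z)) →
  (Σ (Fin n) λ y → y ≢ x × (T (P x) → T (Q y)) × (∀ z → w′ z ≡ (if eqF z y then w z + w x else w z)))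
  ⊎ (¬ T (P x) × (∀ z → w′ z ≡ w z)) →
  Σv (λ z → if P z then w z else 0) ≤ Σv (λ z → if Q z then w′ z else 0)
weight-transfer-≤ {n} P Q w w′ x P⊆Q (inj₁ (y , y≢x , Px⇒Qy , w′≡)) = begin
    Σv inP                                   ≡⟨ Σv≡∑ inP ⟩
    ∑ inP                                    ≡⟨ ∑-split inP x ⟩
    ∑ inP∖x + inP x                          ≤⟨ +-mono-≤ (∑-mono inP∖x≤inQ) (if-mono (w x) Px⇒Qy) ⟩
    ∑ inQ + (if Q y then w x else 0)         ≡⟨ cong (∑ inQ +_) (sym (∑-indicator y (if Q y then w x else 0))) ⟩
    ∑ inQ + ∑ moved                          ≡⟨ sym (∑-distrib-+ inQ moved) ⟩
    ∑ (λ z → inQ z + moved z)                ≡⟨ sum-cong-≗ pointwise ⟩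
    ∑ inQ′                                   ≡⟨ sym (Σv≡∑ inQ′) ⟩
    Σv inQ′ ∎
  where
  open ≤-Reasoning
  inP inP∖x inQ inQ′ moved : Fin n → ℕ
  inP z = if P z then w z else 0
  inP∖x z = if eqF z x then 0 else inP z
  inQ z = if Q z then w z else 0
  inQ′ z = if Q z then w′ z else 0
  moved z = if eqF z y then (if Q y then w x else 0) else 0
  inP∖x≤inQ : ∀ z → inP∖x z ≤ inQ z
  inP∖x≤inQ z with z ≟ x
  ... | yes refl = z≤n
  ... | no z≢x = if-mono (w z) (P⊆Q z z≢x)
  pointwise : ∀ z → inQ z + moved z ≡ inQ′ z
  pointwise z with z ≟ y
  ... | yes refl rewrite w′≡ y | T⇒≡true (eqF-refl y) = sym (if-+ (Q y) (w y) (w x))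
  ... | no z≢y rewrite w′≡ z | ≢⇒eqF≡false z≢y = +-identityʳ _
weight-transfer-≤ {n} P Q w w′ x P⊆Q (inj₂ (¬Px , w′≡w)) = begin
    Σv inP                 ≡⟨ Σv≡∑ inP ⟩
    ∑ inP                  ≡⟨ ∑-split inP x ⟩
    ∑ inP∖x + inP x        ≡⟨ cong (∑ inP∖x +_) (if-false (w x) (¬T⇒≡false ¬Px)) ⟩
    ∑ inP∖x + 0            ≡⟨ +-identityʳ _ ⟩
    ∑ inP∖x                ≤⟨ ∑-mono inP∖x≤inQ′ ⟩
    ∑ inQ′                 ≡⟨ sym (Σv≡∑ inQ′) ⟩
    Σv inQ′ ∎
  where
  open ≤-Reasoning
  inP inP∖x inQ′ : Fin n → ℕ
  inP z = if P z then w z else 0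
  inP∖x z = if eqF z x then 0 else inP z
  inQ′ z = if Q z then w′ z else 0
  inP∖x≤inQ′ : ∀ z → inP∖x z ≤ inQ′ z
  inP∖x≤inQ′ z with z ≟ x
  ... | yes refl = z≤n
  ... | no z≢x = subst (λ t → inP z ≤ (if Q z then t else 0)) (sym (w′≡w z)) (if-mono (w z) (P⊆Q z z≢x))

nth-∈ : ∀ {A : Set} (L : List A) {i a} → nth L i ≡ just a → a ∈ L
nth-∈ (b ∷ L) {zero} refl = here refl
nth-∈ (b ∷ L) {suc i} e = there (nth-∈ L e)

∈⇒nth : ∀ {A : Set} {L : List A} {a} → a ∈ L → Σ ℕ λ i → nth L i ≡ just a
∈⇒nth (here refl) = 0 , refl
∈⇒nth (there m) with ∈⇒nth m
... | i , e = suc i , e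

nth-injective : ∀ {A : Set} {L : List A} → Unique L → ∀ {i j a} → nth L i ≡ just a → nth L j ≡ just a → i ≡ j
nth-injective {L = b ∷ L} u {zero} {zero} e₁ e₂ = refl
nth-injective {L = b ∷ L} (b∉L ∷ u) {zero} {suc j} refl e₂ = ⊥-elim (All.lookup b∉L (nth-∈ L e₂) refl)
nth-injective {L = b ∷ L} (b∉L ∷ u) {suc i} {zero} e₁ refl = ⊥-elim (All.lookup b∉L (nth-∈ L e₁) refl)
nth-injective {L = b ∷ L} (_ ∷ u) {suc i} {suc j} e₁ e₂ = cong suc (nth-injective u e₁ e₂)

nth-defined : ∀ {A : Set} (L : List A) {i} → i < length L → Σ A λ a → nth L i ≡ just a
nth-defined (b ∷ L) {zero} _ = b , refl
nth-defined (b ∷ L) {suc i} (s≤s lt) = nth-defined L lt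

nth-<-length : ∀ {A : Set} (L : List A) {i a} → nth L i ≡ just a → i < length L
nth-<-length (b ∷ L) {zero} _ = s≤s z≤n
nth-<-length (b ∷ L) {suc i} e = s≤s (nth-<-length L e)

isF⇒≡ : ∀ {n} {m : Maybe (Fin n)} {a} → T (isF m a) → m ≡ just a
isF⇒≡ {m = just c} {a} h = cong just (eqF⇒≡ h)

≡⇒isF : ∀ {n} {m : Maybe (Fin n)} {a} → m ≡ just a → T (isF m a)
≡⇒isF {a = a} refl = eqF-refl a

⌊n/2⌋<1+n : ∀ i → ⌊ i /2⌋ < suc i
⌊n/2⌋<1+n i = s≤s (⌊n/2⌋≤n i)

module _ {n : ℕ} (L : List (Fin n)) where

  heapEdgeAt : ℕ → Fin n → Fin n → Bool
  heapEdgeAt i a b = (isF (nth L (suc i)) a ∧ isF (nth L ⌊ i /2⌋) b) ∨ (isF (nth L (suc i)) b ∧ isF (nth L ⌊ i /2⌋) a)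

  -- heapAdj L is heapPrefix L (length L) by definition; building the tree one edge at a time
  -- makes its acyclicity provable by induction.
  heapPrefix : ℕ → Graph n
  heapPrefix k a b = any (λ i → heapEdgeAt i a b) (upTo k)

  HeapEdge : ℕ → Fin n → Fin n → Set
  HeapEdge i a b = nth L (suc i) ≡ just a × nth L ⌊ i /2⌋ ≡ just b

  heapEdgeAt⁻ : ∀ i a b → T (heapEdgeAt i a b) → HeapEdge i a b ⊎ HeapEdge i b a
  heapEdgeAt⁻ i a b h with T-∨⁻ {isF (nth L (suc i)) a ∧ isF (nth L ⌊ i /2⌋) b} h
  ... | inj₁ q = inj₁ (isF⇒≡ (T-∧⁻ˡ q) , isF⇒≡ (T-∧⁻ʳ {isF (nth L (suc i)) a} q))
  ... | inj₂ q = inj₂ (isF⇒≡ (T-∧⁻ˡ q) , isF⇒≡ (T-∧⁻ʳ {isF (nth L (suc i)) b} q))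

  heapEdgeAt⁺ : ∀ i a b → HeapEdge i a b → T (heapEdgeAt i a b)
  heapEdgeAt⁺ i a b (e₁ , e₂) = T-∨⁺ˡ (T-∧⁺ (≡⇒isF e₁) (≡⇒isF e₂))

  heapEdgeAt-sym : ∀ i a b → T (heapEdgeAt i a b) → T (heapEdgeAt i b a)
  heapEdgeAt-sym i a b h with heapEdgeAt⁻ i a b h
  ... | inj₁ (e₁ , e₂) = T-∨⁺ʳ {isF (nth L (suc i)) b ∧ isF (nth L ⌊ i /2⌋) a} (T-∧⁺ (≡⇒isF e₁) (≡⇒isF e₂))
  ... | inj₂ e = heapEdgeAt⁺ i b a e

  heapPrefix⁻ : ∀ k a b → T (heapPrefix k a b) → Σ ℕ λ i → i < k × (HeapEdge i a b ⊎ HeapEdge i b a)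
  heapPrefix⁻ k a b h with any⁻ (λ i → heapEdgeAt i a b) (upTo k) h
  ... | i , m , q = i , ∈-upTo⁻ m , heapEdgeAt⁻ i a b q

  heapPrefix⁺ : ∀ k i a b → i < k → HeapEdge i a b → T (heapPrefix k a b)
  heapPrefix⁺ k i a b lt e = any⁺ (λ i → heapEdgeAt i a b) (∈-upTo⁺ lt) (heapEdgeAt⁺ i a b e)

  heapPrefix-sym : ∀ k a b → T (heapPrefix k a b) → T (heapPrefix k b a)
  heapPrefix-sym k a b h with any⁻ (λ i → heapEdgeAt i a b) (upTo k) h
  ... | i , m , q = any⁺ (λ i → heapEdgeAt i b a) m (heapEdgeAt-sym i a b q)

  heapPrefix-mono : ∀ {k m} → k ≤ m → ∀ a b → T (heapPrefix k a b) → T (heapPrefix m a b)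
  heapPrefix-mono {k} {m} le a b h with heapPrefix⁻ k a b h
  ... | i , lt , inj₁ e = heapPrefix⁺ m i a b (<-≤-trans lt le) e
  ... | i , lt , inj₂ e = heapPrefix-sym m b a (heapPrefix⁺ m i b a (<-≤-trans lt le) e)

  heapPrefix-suc⁻ : ∀ k a b → T (heapPrefix (suc k) a b) → T (heapPrefix k a b) ⊎ (HeapEdge k a b ⊎ HeapEdge k b a)
  heapPrefix-suc⁻ k a b h with heapPrefix⁻ (suc k) a b h
  ... | i , s≤s lt , e with m≤n⇒m<n∨m≡n lt
  ... | inj₂ refl = inj₂ e
  ... | inj₁ lt' with e
  ... | inj₁ e' = inj₁ (heapPrefix⁺ k i a b lt' e')
  ... | inj₂ e' = inj₁ (heapPrefix-sym k b a (heapPrefix⁺ k i b a lt' e'))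

  HeapEdge-∈ : ∀ {i a b} → HeapEdge i a b → a ∈ L × b ∈ L
  HeapEdge-∈ (e₁ , e₂) = nth-∈ L e₁ , nth-∈ L e₂

  heapPrefix-∈ : ∀ k a b → T (heapPrefix k a b) → a ∈ L × b ∈ L
  heapPrefix-∈ k a b h with heapPrefix⁻ k a b h
  ... | _ , _ , inj₁ e = HeapEdge-∈ e
  ... | _ , _ , inj₂ e with HeapEdge-∈ e
  ... | p , q = q , p

  heapPrefix-irrefl : Unique L → ∀ k a → ¬ T (heapPrefix k a a)
  heapPrefix-irrefl u k a h with heapPrefix⁻ k a a h
  ... | i , _ , inj₁ (e₁ , e₂) = <-irrefl (sym (nth-injective u e₁ e₂)) (⌊n/2⌋<1+n i)
  ... | i , _ , inj₂ (e₁ , e₂) = <-irrefl (sym (nth-injective u e₁ e₂)) (⌊n/2⌋<1+n i)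

  heapPrefix-suc-beyond : ∀ k a b → length L ≤ suc k → T (heapPrefix (suc k) a b) → T (heapPrefix k a b)
  heapPrefix-suc-beyond k a b le h with heapPrefix-suc⁻ k a b h
  ... | inj₁ q = q
  ... | inj₂ (inj₁ (e₁ , _)) = ⊥-elim (<-irrefl refl (<-≤-trans (nth-<-length L e₁) le))
  ... | inj₂ (inj₂ (e₁ , _)) = ⊥-elim (<-irrefl refl (<-≤-trans (nth-<-length L e₁) le))

live-source : ∀ {n} (ok : Fin n → Bool) (R : Graph n) {a b} → T (ok a ∧ ok b ∧ R a b) → T (ok a)
live-source ok R {a} h = T-∧⁻ˡ h

live-target : ∀ {n} (ok : Fin n → Bool) (R : Graph n) {a b} → T (ok a ∧ ok b ∧ R a b) → T (ok b)
live-target ok R {a} {b} h = T-∧⁻ˡ (T-∧⁻ʳ {ok a} h)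

live-edge : ∀ {n} (ok : Fin n → Bool) (R : Graph n) {a b} → T (ok a ∧ ok b ∧ R a b) → T (R a b)
live-edge ok R {a} {b} h = T-∧⁻ʳ {ok b} (T-∧⁻ʳ {ok a} h)

record Invariant {n} (s : State n) : Set where
  field
    heal-sym    : ∀ a b → heal s a b ≡ heal s b a
    heal-irrefl : ∀ a → heal s a a ≡ false
    forest      : Forest (alive s) (adjG' s)
    ID-const    : ∀ a b → Path (alive s) (adjG' s) a b → ID s a ≡ ID s b

adjG'-sym : ∀ {n} {s : State n} → Invariant s → Symmetric (adjG' s)
adjG'-sym {s = s} I a b h =
  T-∧⁺ (live-target (alive s) (heal s) h)
       (T-∧⁺ (live-source (alive s) (heal s) h) (subst T (Invariant.heal-sym I a b) (live-edge (alive s) (heal s) h)))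

adjG'-within : ∀ {n} (s : State n) → EdgesWithin (alive s) (adjG' s)
adjG'-within s a b h = live-source (alive s) (heal s) h , live-target (alive s) (heal s) h

adjG'⇒heal : ∀ {n} (s : State n) {a b} → T (adjG' s a b) → T (heal s a b)
adjG'⇒heal s {a} {b} h = T-∧⁻ʳ {alive s b} (T-∧⁻ʳ {alive s a} h)

adjG'⁺ : ∀ {n} (s : State n) {a b} → T (alive s a) → T (alive s b) → T (heal s a b) → T (adjG' s a b)
adjG'⁺ s a-alive b-alive a-b = T-∧⁺ a-alive (T-∧⁺ b-alive a-b)

module DashStep {n : ℕ} (E₀ : Graph n) (id₀ : Fin n → ℕ)
                (inj : ∀ u v → id₀ u ≡ id₀ v → u ≡ v)
                {s s' : State n} (x : Fin n) (st : Step E₀ id₀ x s s') (I : Invariant s) where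

  open Invariant I
  open Step st

  live live′ S UN : Fin n → Bool
  live = alive s
  live′ = alive s'
  S = inS E₀ id₀ s x
  UN = inUN E₀ id₀ s x

  F F′ : Graph n
  F = adjG' s
  F′ = adjG' s'

  L SL : List (Fin n)
  L = order
  SL = SList E₀ id₀ s x

  live′⇒without : ∀ {z} → T (live′ z) → T (without live x z)
  live′⇒without {z} h = subst T (alive-new z) h

  live′⇒ : ∀ {z} → T (live′ z) → T (live z) × z ≢ x
  live′⇒ h = without-ok {ok = live} (live′⇒without h) , without-≢ {ok = live} (live′⇒without h)

  live′⁺ : ∀ {z} → T (live z) → z ≢ x → T (live′ z)
  live′⁺ {z} h z≢x = subst T (sym (alive-new z)) (without⁺ {ok = live} h z≢x)

  without-live′⇒without-live : ∀ {v z} → T (without live′ v z) → T (without live v z)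
  without-live′⇒without-live {v} h =
    without⁺ {ok = live} (proj₁ (live′⇒ (without-ok {ok = live′} {v} h))) (without-≢ {ok = live′} h)

  S⇒UN⊎nbr : ∀ {a} → T (S a) → T (UN a) ⊎ T (F x a)
  S⇒UN⊎nbr {a} h = T-∨⁻ {UN a} h

  UN-adj : ∀ {a} → T (UN a) → T (adjG E₀ s x a)
  UN-adj h = T-∧⁻ˡ h

  UN-live : ∀ {a} → T (UN a) → T (live a)
  UN-live h = T-∧⁻ˡ (T-∧⁻ʳ {live x} (UN-adj h))

  UN-ID-≢ : ∀ {a} → T (UN a) → ID s a ≢ ID s x
  UN-ID-≢ {a} h e = T-not⁻ (T-∧⁻ˡ (T-∧⁻ʳ {adjG E₀ s x a} h)) (≡⇒≡ᵇ (ID s a) (ID s x) e)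

  UN-lowest : ∀ {a} → T (UN a) → ∀ u → T (not (adjG E₀ s x u ∧ (ID s u ≡ᵇ ID s a)) ∨ (id₀ a ≤ᵇ id₀ u))
  UN-lowest {a} a∈UN u =
    All.lookup (All.all⁺ (λ u → not (adjG E₀ s x u ∧ (ID s u ≡ᵇ ID s a)) ∨ (id₀ a ≤ᵇ id₀ u)) (allFin n)
                         (T-∧⁻ʳ {not (ID s a ≡ᵇ ID s x)} (T-∧⁻ʳ {adjG E₀ s x a} a∈UN)))
               (∈-allFin u)

  UN-id₀-≤ : ∀ {a b} → T (UN a) → T (UN b) → ID s a ≡ ID s b → id₀ a ≤ id₀ b
  UN-id₀-≤ {a} {b} a∈UN b∈UN same-ID with T-∨⁻ {not (adjG E₀ s x b ∧ (ID s b ≡ᵇ ID s a))} (UN-lowest a∈UN b)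
  ... | inj₁ b∉class = ⊥-elim (T-not⁻ b∉class (T-∧⁺ (UN-adj b∈UN) (≡⇒≡ᵇ (ID s b) (ID s a) (sym same-ID))))
  ... | inj₂ a≤b = ≤ᵇ⇒≤ (id₀ a) (id₀ b) a≤b

  UN-unique : ∀ {a b} → T (UN a) → T (UN b) → ID s a ≡ ID s b → a ≡ b
  UN-unique a∈UN b∈UN same-ID = inj _ _ (≤-antisym (UN-id₀-≤ a∈UN b∈UN same-ID) (UN-id₀-≤ b∈UN a∈UN (sym same-ID)))

  S-live : ∀ {a} → T (S a) → T (live a)
  S-live h with S⇒UN⊎nbr h
  ... | inj₁ a∈UN = UN-live a∈UN
  ... | inj₂ x-a = proj₂ (adjG'-within s x _ x-a)

  S-≢x : ∀ {a} → T (S a) → a ≢ x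
  S-≢x h refl with S⇒UN⊎nbr h
  ... | inj₁ x∈UN = UN-ID-≢ x∈UN refl
  ... | inj₂ x-x = subst T (heal-irrefl x) (adjG'⇒heal s x-x)

  S-live′ : ∀ {a} → T (S a) → T (live′ a)
  S-live′ h = live′⁺ (S-live h) (S-≢x h)

  nbr⇒S : ∀ {a} → T (F x a) → T (S a)
  nbr⇒S {a} h = T-∨⁺ʳ {UN a} h

  nbr-ID : ∀ {a} → T (F x a) → ID s a ≡ ID s x
  nbr-ID h = ID-const _ _ (path-edge (proj₂ (adjG'-within s x _ h)) (adjG'-sym I _ _ h) (proj₁ (adjG'-within s x _ h)))

  -- This is where UN keeps a single representative of each ID class.
  S-separated : ∀ {a b} → T (S a) → T (S b) → a ≢ b → ¬ Path (without live x) F a b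
  S-separated {a} {b} a∈S b∈S a≢b P with S⇒UN⊎nbr a∈S | S⇒UN⊎nbr b∈S
  ... | inj₁ a∈UN | inj₁ b∈UN = a≢b (UN-unique a∈UN b∈UN (ID-const a b (path-unwithout {ok = live} {v = x} P)))
  ... | inj₁ a∈UN | inj₂ x-b = UN-ID-≢ a∈UN (trans (ID-const a b (path-unwithout {ok = live} {v = x} P)) (nbr-ID x-b))
  ... | inj₂ x-a | inj₁ b∈UN =
    UN-ID-≢ b∈UN (trans (ID-const b a (path-sym (adjG'-sym I) (path-unwithout {ok = live} {v = x} P))) (nbr-ID x-a))
  ... | inj₂ x-a | inj₂ x-b = forest x a b x-a x-b a≢b P

  SList-unique : Unique SL
  SList-unique = filter⁺ (λ a → T? (S a)) (allFin⁺ n)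

  order-unique : Unique L
  order-unique = Permutationₛ.Unique-resp-↭ (setoid (Fin n)) (↭⇒↭ₛ (↭-sym order-S)) SList-unique

  order⇒S : ∀ {a} → a ∈ L → T (S a)
  order⇒S m = proj₂ (∈-filter⁻ (T? ∘ S) {xs = allFin n} (Any-resp-↭ order-S m))

  S⇒order : ∀ {a} → T (S a) → a ∈ L
  S⇒order {a} h = Any-resp-↭ (↭-sym order-S) (∈-filter⁺ (T? ∘ S) (∈-allFin a) h)

  S⇒SList : ∀ {a} → T (S a) → a ∈ SL
  S⇒SList {a} h = ∈-filter⁺ (T? ∘ S) (∈-allFin a) h

  healOrHeap : ℕ → Graph n
  healOrHeap k a b = heal s a b ∨ heapPrefix L k a b

  Fk : ℕ → Graph n
  Fk k a b = live′ a ∧ live′ b ∧ healOrHeap k a b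

  Fk-source : ∀ k {a b} → T (Fk k a b) → T (live′ a)
  Fk-source k = live-source live′ (healOrHeap k)

  Fk-target : ∀ k {a b} → T (Fk k a b) → T (live′ b)
  Fk-target k = live-target live′ (healOrHeap k)

  Fk-edge : ∀ k {a b} → T (Fk k a b) → T (healOrHeap k a b)
  Fk-edge k = live-edge live′ (healOrHeap k)

  F′⇒Fk : ∀ a b → T (F′ a b) → T (Fk (length L) a b)
  F′⇒Fk a b h = T-∧⁺ (live-source live′ (heal s') h) (T-∧⁺ (live-target live′ (heal s') h) edge)
    where
    edge : T (healOrHeap (length L) a b)
    edge with T-∨⁻ {heal s a b ∧ not (eqF a x) ∧ not (eqF b x)} (subst T (heal-new a b) (adjG'⇒heal s' h))
    ... | inj₁ old  = T-∨⁺ˡ (T-∧⁻ˡ {heal s a b} old)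
    ... | inj₂ heap = T-∨⁺ʳ {heal s a b} heap

  Fk⇒F′ : ∀ a b → T (Fk (length L) a b) → T (F′ a b)
  Fk⇒F′ a b h = adjG'⁺ s' a-live′ b-live′ (subst T (sym (heal-new a b)) edge)
    where
    a-live′ : T (live′ a)
    a-live′ = Fk-source (length L) h
    b-live′ : T (live′ b)
    b-live′ = Fk-target (length L) h
    edge : T ((heal s a b ∧ not (eqF a x) ∧ not (eqF b x)) ∨ heapAdj L a b)
    edge with T-∨⁻ {heal s a b} (Fk-edge (length L) h)
    ... | inj₁ old  = T-∨⁺ˡ (T-∧⁺ old (T-∧⁺ (T-not⁺ (λ a≡x → proj₂ (live′⇒ a-live′) (eqF⇒≡ a≡x)))
                                              (T-not⁺ (λ b≡x → proj₂ (live′⇒ b-live′) (eqF⇒≡ b≡x)))))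
    ... | inj₂ heap = T-∨⁺ʳ {heal s a b ∧ not (eqF a x) ∧ not (eqF b x)} heap

  Fk-sym : ∀ k → Symmetric (Fk k)
  Fk-sym k a b h = T-∧⁺ (Fk-target k h) (T-∧⁺ (Fk-source k h) edge)
    where
    edge : T (healOrHeap k b a)
    edge with T-∨⁻ {heal s a b} (Fk-edge k h)
    ... | inj₁ old  = T-∨⁺ˡ (subst T (heal-sym a b) old)
    ... | inj₂ heap = T-∨⁺ʳ {heal s b a} (heapPrefix-sym L k a b heap)

  Fk-within : ∀ k → EdgesWithin live′ (Fk k)
  Fk-within k a b h = Fk-source k h , Fk-target k h

  Fk-mono : ∀ {k m} → k ≤ m → ∀ a b → T (Fk k a b) → T (Fk m a b)
  Fk-mono {k} {m} k≤m a b h = T-∧⁺ (Fk-source k h) (T-∧⁺ (Fk-target k h) edge)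
    where
    edge : T (healOrHeap m a b)
    edge with T-∨⁻ {heal s a b} (Fk-edge k h)
    ... | inj₁ old  = T-∨⁺ˡ old
    ... | inj₂ heap = T-∨⁺ʳ {heal s a b} (heapPrefix-mono L k≤m a b heap)

  Fk-edge-cases : ∀ k a b → T (Fk k a b) → T (F a b) ⊎ (T (S a) × T (S b))
  Fk-edge-cases k a b h with T-∨⁻ {heal s a b} (Fk-edge k h)
  ... | inj₁ old  = inj₁ (adjG'⁺ s (proj₁ (live′⇒ (Fk-source k h))) (proj₁ (live′⇒ (Fk-target k h))) old)
  ... | inj₂ heap = inj₂ (order⇒S (proj₁ (heapPrefix-∈ L k a b heap)) , order⇒S (proj₂ (heapPrefix-∈ L k a b heap)))

  F′-edge-cases : ∀ a b → T (F′ a b) → T (F a b) ⊎ (T (S a) × T (S b))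
  F′-edge-cases a b h = Fk-edge-cases (length L) a b (F′⇒Fk a b h)

  F₀⇒F : ∀ a b → T (Fk 0 a b) → T (F a b)
  F₀⇒F a b h with T-∨⁻ {heal s a b} (Fk-edge 0 h)
  ... | inj₁ old = adjG'⁺ s (proj₁ (live′⇒ (Fk-source 0 h))) (proj₁ (live′⇒ (Fk-target 0 h))) old
  ... | inj₂ ()

  F⇒Fk : ∀ k a b → T (live′ a) → T (live′ b) → T (F a b) → T (Fk k a b)
  F⇒Fk k a b a-live′ b-live′ h = T-∧⁺ a-live′ (T-∧⁺ b-live′ (T-∨⁺ˡ (adjG'⇒heal s h)))

  F⇒F′ : ∀ a b → T (live′ a) → T (live′ b) → T (F a b) → T (F′ a b)
  F⇒F′ a b a-live′ b-live′ h = Fk⇒F′ a b (F⇒Fk (length L) a b a-live′ b-live′ h)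

  F′-sym : Symmetric F′
  F′-sym a b h = Fk⇒F′ b a (Fk-sym (length L) a b (F′⇒Fk a b h))

  F₀-path⇒F-path : ∀ {a b} → Path live′ (Fk 0) a b → Path (without live x) F a b
  F₀-path⇒F-path = path-map (λ _ → live′⇒without) F₀⇒F

  nth⇒S : ∀ {i a} → nth L i ≡ just a → T (S a)
  nth⇒S e = order⇒S (nth-∈ L e)

  nth-separated : ∀ {i j a b} → nth L i ≡ just a → nth L j ≡ just b → i ≢ j → ¬ Path live′ (Fk 0) a b
  nth-separated {a = a} {b} at-a at-b i≢j P = S-separated (nth⇒S at-a) (nth⇒S at-b) a≢b (F₀-path⇒F-path P)
    where
    a≢b : a ≢ b
    a≢b refl = i≢j (nth-injective order-unique at-a at-b)

  forest₀ : Forest live′ (Fk 0)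
  forest₀ v u₁ u₂ e₁ e₂ u₁≢u₂ P =
    forest v u₁ u₂ (F₀⇒F _ _ e₁) (F₀⇒F _ _ e₂) u₁≢u₂ (path-map (λ _ → without-live′⇒without-live) F₀⇒F P)

  -- Positions beyond k carry no heap edge of Fk k yet.
  Untouched : ℕ → Set
  Untouched k = ∀ p c z → k < p → nth L p ≡ just c → Path live′ (Fk k) c z → Path live′ (Fk 0) c z

  Fk-suc-beyond : ∀ k → length L ≤ suc k → ∀ a b → T (Fk (suc k) a b) → T (Fk k a b)
  Fk-suc-beyond k len≤k+1 a b h = T-∧⁺ (Fk-source (suc k) h) (T-∧⁺ (Fk-target (suc k) h) edge)
    where
    edge : T (heal s a b ∨ heapPrefix L k a b)
    edge with T-∨⁻ {heal s a b} (Fk-edge (suc k) h)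
    ... | inj₁ old  = T-∨⁺ˡ old
    ... | inj₂ heap = T-∨⁺ʳ {heal s a b} (heapPrefix-suc-beyond L k a b len≤k+1 heap)

  module _ (k : ℕ) (k+1<len : suc k < length L) (forest-k : Forest live′ (Fk k)) (untouched-k : Untouched k) where

    private
      parent<len : ⌊ k /2⌋ < length L
      parent<len = <-trans (⌊n/2⌋<1+n k) k+1<len

      child parent : Fin n
      child = proj₁ (nth-defined L k+1<len)
      parent = proj₁ (nth-defined L parent<len)

      at-child : nth L (suc k) ≡ just child
      at-child = proj₂ (nth-defined L k+1<len)
      at-parent : nth L ⌊ k /2⌋ ≡ just parent
      at-parent = proj₂ (nth-defined L parent<len)

      ¬child⇝parent : ¬ Path live′ (Fk k) child parent
      ¬child⇝parent P = nth-separated at-child at-parent (λ e → <-irrefl (sym e) (⌊n/2⌋<1+n k))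
                          (untouched-k (suc k) child parent (n<1+n k) at-child P)

      Fk-suc-edge : ∀ p q → T (Fk (suc k) p q) →
                    T (Fk k p q) ⊎ ((p ≡ child × q ≡ parent) ⊎ (p ≡ parent × q ≡ child))
      Fk-suc-edge p q h with T-∨⁻ {heal s p q} (Fk-edge (suc k) h)
      ... | inj₁ old = inj₁ (T-∧⁺ (Fk-source (suc k) h) (T-∧⁺ (Fk-target (suc k) h) (T-∨⁺ˡ old)))
      ... | inj₂ heap with heapPrefix-suc⁻ L k p q heap
      ... | inj₁ earlier = inj₁ (T-∧⁺ (Fk-source (suc k) h) (T-∧⁺ (Fk-target (suc k) h) (T-∨⁺ʳ {heal s p q} earlier)))
      ... | inj₂ (inj₁ (e₁ , e₂)) =
        inj₂ (inj₁ (just-injective (trans (sym e₁) at-child) , just-injective (trans (sym e₂) at-parent)))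
      ... | inj₂ (inj₂ (e₁ , e₂)) =
        inj₂ (inj₂ (just-injective (trans (sym e₂) at-parent) , just-injective (trans (sym e₁) at-child)))

      Ends : Fin n → Bool
      Ends z = eqF z child ∨ eqF z parent

      split : ∀ p q → T (live′ p) → T (live′ q) → T (Fk (suc k) p q) → T (Fk k p q) ⊎ (T (Ends p) × T (Ends q))
      split p q _ _ h with Fk-suc-edge p q h
      ... | inj₁ old = inj₁ old
      ... | inj₂ (inj₁ (refl , refl)) = inj₂ (T-∨⁺ˡ (eqF-refl child) , T-∨⁺ʳ {eqF parent child} (eqF-refl parent))
      ... | inj₂ (inj₂ (refl , refl)) = inj₂ (T-∨⁺ʳ {eqF parent child} (eqF-refl parent) , T-∨⁺ˡ (eqF-refl child))

    forest-suc : Forest live′ (Fk (suc k))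
    forest-suc = forest-add-edge (Fk-sym k) (Fk-sym (suc k)) (Fk-within k) forest-k
                   (S-live′ (nth⇒S at-child)) ¬child⇝parent Fk-suc-edge

    untouched-suc : Untouched (suc k)
    untouched-suc p c z k+1<p at-c P with path-split Ends (Fk-sym k) split P
    ... | inj₁ P′ = untouched-k p c z (<-trans (n<1+n k) k+1<p) at-c P′
    ... | inj₂ ((d , d∈ends , c⇝d) , _) with T-∨⁻ {eqF d child} d∈ends
    ... | inj₁ d≡child with eqF⇒≡ {u = d} {child} d≡child
    ... | refl = ⊥-elim (nth-separated at-c at-child (λ e → <-irrefl (sym e) k+1<p)
                           (untouched-k p c d (<-trans (n<1+n k) k+1<p) at-c c⇝d))
    untouched-suc p c z k+1<p at-c P | inj₂ ((d , d∈ends , c⇝d) , _) | inj₂ d≡parent with eqF⇒≡ {u = d} {parent} d≡parent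
    ... | refl = ⊥-elim (nth-separated at-c at-parent (λ e → <-irrefl (sym e) (<-trans (⌊n/2⌋<1+n k) k+1<p))
                           (untouched-k p c d (<-trans (n<1+n k) k+1<p) at-c c⇝d))

  -- Heap edge k joins the untouched position k + 1 to its parent ⌊k/2⌋, which by S-separated
  -- lies in another tree; so every edge added keeps a forest.
  heap-growth : ∀ k → Forest live′ (Fk k) × Untouched k
  heap-growth zero = forest₀ , λ _ _ _ _ _ P → P
  heap-growth (suc k) with heap-growth k | suc k <? length L
  ... | forest-k , untouched-k | yes k+1<len = forest-suc k k+1<len forest-k untouched-k , untouched-suc k k+1<len forest-k untouched-k
  ... | forest-k , untouched-k | no k+1≮len =
    forest-⊆ forest-k (Fk-suc-beyond k (≮⇒≥ k+1≮len)) ,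
    λ p c z k+1<p at-c P → untouched-k p c z (<-trans (n<1+n k) k+1<p) at-c (path-map (λ _ o → o) (Fk-suc-beyond k (≮⇒≥ k+1≮len)) P)

  forest′ : Forest live′ F′
  forest′ = forest-⊆ (proj₁ (heap-growth (length L))) F′⇒Fk

  heap-root-path : ∀ {root} → nth L 0 ≡ just root → ∀ f i → i < f → ∀ {a} → nth L i ≡ just a →
                   Path live′ (Fk (length L)) root a
  heap-root-path at-root (suc f) zero _ at-a with just-injective (trans (sym at-root) at-a)
  ... | refl = here (S-live′ (nth⇒S at-root))
  heap-root-path at-root (suc f) (suc j) (s≤s j<f) {a} at-a
    with nth-defined L {⌊ j /2⌋} (<-trans (⌊n/2⌋<1+n j) (nth-<-length L at-a))
  ... | c , at-c = step (heap-root-path at-root f ⌊ j /2⌋ (≤-<-trans (⌊n/2⌋≤n j) j<f) at-c)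
                        (T-∧⁺ (S-live′ (nth⇒S at-c)) (T-∧⁺ (S-live′ (nth⇒S at-a)) (T-∨⁺ʳ {heal s c a} c-a)))
                        (S-live′ (nth⇒S at-a))
    where
    c-a : T (heapPrefix L (length L) c a)
    c-a = heapPrefix-sym L (length L) a c
            (heapPrefix⁺ L (length L) j a c (<-trans (n<1+n j) (nth-<-length L at-a)) (at-a , at-c))

  S-connected′ : ∀ {a b} → T (S a) → T (S b) → Path live′ F′ a b
  S-connected′ {a} {b} a∈S b∈S with ∈⇒nth (S⇒order a∈S) | ∈⇒nth (S⇒order b∈S)
  ... | i , at-a | j , at-b with nth-defined L {0} (≤-<-trans z≤n (nth-<-length L at-a))
  ... | root , at-root = path-map (λ _ o → o) Fk⇒F′
                           (path-trans (path-sym (Fk-sym (length L)) (heap-root-path at-root (suc i) i ≤-refl at-a))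
                                       (heap-root-path at-root (suc j) j ≤-refl at-b))

  heal′-sym : ∀ a b → heal s' a b ≡ heal s' b a
  heal′-sym a b = begin
      heal s' a b
        ≡⟨ heal-new a b ⟩
      (heal s a b ∧ not (eqF a x) ∧ not (eqF b x)) ∨ heapAdj L a b
        ≡⟨ cong₂ _∨_ (cong₂ _∧_ (heal-sym a b) (∧-comm (not (eqF a x)) (not (eqF b x))))
                     (T⇔T⇒≡ (heapPrefix-sym L (length L) a b) (heapPrefix-sym L (length L) b a)) ⟩
      (heal s b a ∧ not (eqF b x) ∧ not (eqF a x)) ∨ heapAdj L b a
        ≡⟨ sym (heal-new b a) ⟩
      heal s' b a ∎
    where open ≡-Reasoning

  heal′-irrefl : ∀ a → heal s' a a ≡ false
  heal′-irrefl a = trans (heal-new a a)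
    (trans (cong (λ t → (t ∧ not (eqF a x) ∧ not (eqF a x)) ∨ heapAdj L a a) (heal-irrefl a))
           (¬T⇒≡false (heapPrefix-irrefl L order-unique (length L) a)))

  touches-S : Fin n → Bool
  touches-S a = any (λ u → reach live′ F′ u a) SL

  touches-S-path : ∀ {a b} → Path live′ F′ a b → T (touches-S a) → T (touches-S b)
  touches-S-path {a} {b} a⇝b h with any⁻ (λ u → reach live′ F′ u a) SL h
  ... | u , u∈SL , u⇝a = any⁺ (λ u → reach live′ F′ u b) u∈SL (Path⇒reach (path-trans (reach⇒Path u⇝a) a⇝b))

  -- A new tree avoiding S is a tree of F − x, so it keeps its old, constant ID.
  ID′-const-untouched : ∀ {a b} → Path live′ F′ a b → ¬ T (touches-S a) → ID s a ≡ ID s b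
  ID′-const-untouched {a} {b} a⇝b ¬touches with path-split S (Fk-sym 0) split a⇝b
    where
    split : ∀ p q → T (live′ p) → T (live′ q) → T (F′ p q) → T (Fk 0 p q) ⊎ (T (S p) × T (S q))
    split p q p-live q-live h with F′-edge-cases p q h
    ... | inj₁ old = inj₁ (F⇒Fk 0 p q p-live q-live old)
    ... | inj₂ new = inj₂ new
  ... | inj₁ P = ID-const a b (path-unwithout {ok = live} {v = x} (F₀-path⇒F-path P))
  ... | inj₂ ((u , u∈S , a⇝u) , _) =
    ⊥-elim (¬touches (any⁺ (λ u → reach live′ F′ u a) (S⇒SList u∈S)
                       (Path⇒reach (path-sym F′-sym (path-map (λ _ o → o) Fk0⇒F′ a⇝u)))))
    where
    Fk0⇒F′ : ∀ p q → T (Fk 0 p q) → T (F′ p q)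
    Fk0⇒F′ p q h = Fk⇒F′ p q (Fk-mono {0} {length L} z≤n p q h)

  ID′-const : ∀ a b → Path live′ F′ a b → ID s' a ≡ ID s' b
  ID′-const a b a⇝b = trans (ID-new a) (trans (by-cases (T? (touches-S a))) (sym (ID-new b)))
    where
    by-cases : Dec (T (touches-S a)) →
               (if touches-S a then minOn (ID s) SL else ID s a) ≡ (if touches-S b then minOn (ID s) SL else ID s b)
    by-cases (yes h) rewrite T⇒≡true h | T⇒≡true (touches-S-path a⇝b h) = refl
    by-cases (no ¬h) rewrite ¬T⇒≡false ¬h | ¬T⇒≡false (λ h → ¬h (touches-S-path (path-sym F′-sym a⇝b) h)) =
      ID′-const-untouched a⇝b ¬h

  invariant′ : Invariant s'
  invariant′ = record { heal-sym = heal′-sym ; heal-irrefl = heal′-irrefl ; forest = forest′ ; ID-const = ID′-const }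

invariant-init : ∀ {n} (E₀ : Graph n) (id₀ : Fin n → ℕ) → Invariant (initState E₀ id₀)
invariant-init E₀ id₀ = record
  { heal-sym = λ _ _ → refl ; heal-irrefl = λ _ → refl ; forest = λ _ _ _ () ; ID-const = no-edges }
  where
  no-edges : ∀ a b → Path (λ _ → true) (adjG' (initState E₀ id₀)) a b → id₀ a ≡ id₀ b
  no-edges a .a (here _) = refl
  no-edges a b (step _ () _)

invariant-run : ∀ {n} (E₀ : Graph n) (id₀ : Fin n → ℕ) → (∀ u v → id₀ u ≡ id₀ v → u ≡ v) →
                ∀ {s} → Run E₀ id₀ s → Invariant s
invariant-run E₀ id₀ inj start = invariant-init E₀ id₀
invariant-run E₀ id₀ inj (step x r st) = DashStep.invariant′ E₀ id₀ inj x st (invariant-run E₀ id₀ inj r)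

module _ where
  open +-*-Solver

  +-swap-outer : ∀ a b c → (a + b) + c ≡ (c + b) + a
  +-swap-outer = solve 3 (λ a b c → (a :+ b) :+ c := (c :+ b) :+ a) refl

  cross-≤⇒∸-≤ : ∀ a m c a′ m′ c′ → m ≤ a → m′ ≤ a′ → (a + c) + m′ ≤ (a′ + c′) + m →
                (a ∸ m) + c ≤ (a′ ∸ m′) + c′
  cross-≤⇒∸-≤ a m c a′ m′ c′ m≤a m′≤a′ h = +-cancelˡ-≤ (m + m′) _ _ (begin
      (m + m′) + ((a ∸ m) + c)       ≡⟨ shuffle (a ∸ m) m c m′ ⟩
      (((a ∸ m) + m) + c) + m′       ≡⟨ cong (λ t → (t + c) + m′) (m∸n+n≡m m≤a) ⟩
      (a + c) + m′                   ≤⟨ h ⟩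
      (a′ + c′) + m                  ≡⟨ cong (λ t → (t + c′) + m) (sym (m∸n+n≡m m′≤a′)) ⟩
      (((a′ ∸ m′) + m′) + c′) + m    ≡⟨ shuffle′ (a′ ∸ m′) m′ c′ m ⟩
      (m + m′) + ((a′ ∸ m′) + c′)    ∎)
    where
    open ≤-Reasoning
    shuffle : ∀ r m c m′ → (m + m′) + (r + c) ≡ ((r + m) + c) + m′
    shuffle = solve 4 (λ r m c m′ → (m :+ m′) :+ (r :+ c) := ((r :+ m) :+ c) :+ m′) refl
    shuffle′ : ∀ r m′ c m → ((r + m′) + c) + m ≡ (m + m′) + (r + c)
    shuffle′ = solve 4 (λ r m′ c m → ((r :+ m′) :+ c) :+ m := (m :+ m′) :+ (r :+ c)) refl

module RemMonotone {n : ℕ} (E₀ : Graph n) (id₀ : Fin n → ℕ)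
                   (inj : ∀ u v → id₀ u ≡ id₀ v → u ≡ v)
                   {s s' : State n} (x : Fin n) (st : Step E₀ id₀ x s s') (I : Invariant s)
                   (v : Fin n) (v-live′ : T (alive s' v)) where

  open DashStep E₀ id₀ inj x st I
  open Invariant I
  open Step st using (x-alive; w-new)

  v-live : T (live v)
  v-live = proj₁ (live′⇒ v-live′)

  v≢x : v ≢ x
  v≢x = proj₂ (live′⇒ v-live′)

  x≢v : x ≢ v
  x≢v x≡v = v≢x (sym x≡v)

  live∖v live′∖v : Fin n → Bool
  live∖v = without live v
  live′∖v = without live′ v

  F-sym : Symmetric F
  F-sym = adjG'-sym I

  old-path-survives : ∀ {z} → Path live F v z → (z ≢ x → Path live′ F′ v z) × (z ≡ x → PathToSet live′ F′ S v)
  old-path-survives (here o) = (λ _ → here v-live′) , (λ v≡x → ⊥-elim (v≢x v≡x))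
  old-path-survives {z} (step {y} P e o) with old-path-survives P | y ≟ x | z ≟ x
  ... | _ , to-S | yes refl | yes refl = (λ x≢x → ⊥-elim (x≢x refl)) , (λ _ → to-S refl)
  ... | _ , to-S | yes refl | no z≢x = (λ _ → via-S (to-S refl)) , (λ z≡x → ⊥-elim (z≢x z≡x))
    where
    via-S : PathToSet live′ F′ S v → Path live′ F′ v z
    via-S (a , a∈S , v⇝a) = path-trans v⇝a (S-connected′ a∈S (nbr⇒S e))
  ... | to-y , _ | no y≢x | yes refl = (λ x≢x → ⊥-elim (x≢x refl)) , (λ _ → y , nbr⇒S (F-sym y x e) , to-y y≢x)
  ... | to-y , _ | no y≢x | no z≢x =
    (λ _ → step (to-y y≢x) (F⇒F′ y z (live′⁺ (target-ok P) y≢x) (live′⁺ o z≢x) e) (live′⁺ o z≢x)) ,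
    (λ z≡x → ⊥-elim (z≢x z≡x))

  path-survives : ∀ {z} → Path live F v z → z ≢ x → Path live′ F′ v z
  path-survives P = proj₁ (old-path-survives P)

  F₀∖v⇒F∖v : ∀ {a b} → Path live′∖v (Fk 0) a b → Path live∖v F a b
  F₀∖v⇒F∖v = path-map (λ _ → without-live′⇒without-live) F₀⇒F

  new-path-split : ∀ {p q} → Path live′∖v F′ p q →
                   Path live∖v F p q ⊎ (PathToSet live∖v F S p × PathToSet live∖v F S q)
  new-path-split P with path-split S (Fk-sym 0) split P
    where
    split : ∀ p q → T (live′∖v p) → T (live′∖v q) → T (F′ p q) → T (Fk 0 p q) ⊎ (T (S p) × T (S q))
    split p q p-ok q-ok h with F′-edge-cases p q h
    ... | inj₁ old = inj₁ (F⇒Fk 0 p q (without-ok {ok = live′} {v} p-ok) (without-ok {ok = live′} {v} q-ok) old)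
    ... | inj₂ new = inj₂ new
  ... | inj₁ Q = inj₁ (F₀∖v⇒F∖v Q)
  ... | inj₂ ((a , a∈S , p⇝a) , (b , b∈S , q⇝b)) = inj₂ ((a , a∈S , F₀∖v⇒F∖v p⇝a) , (b , b∈S , F₀∖v⇒F∖v q⇝b))

  -- The vertices through which the round can alter the old tree of v.
  Special : Fin n → Set
  Special z = (T (S z) ⊎ z ≡ x) × z ≢ v × Path live F v z

  special? : Fin n → Bool
  special? z = (S z ∨ eqF z x) ∧ not (eqF z v) ∧ reach live F v z

  special?⇒ : ∀ {z} → T (special? z) → Special z
  special?⇒ {z} h = S-or-x (T-∨⁻ {S z} (T-∧⁻ˡ h)) ,
                    (λ z≡v → T-not⁻ (T-∧⁻ˡ (T-∧⁻ʳ {S z ∨ eqF z x} h)) (subst (λ t → T (eqF z t)) z≡v (eqF-refl z))) ,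
                    reach⇒Path (T-∧⁻ʳ {not (eqF z v)} (T-∧⁻ʳ {S z ∨ eqF z x} h))
    where
    S-or-x : T (S z) ⊎ T (eqF z x) → T (S z) ⊎ z ≡ x
    S-or-x (inj₁ z∈S) = inj₁ z∈S
    S-or-x (inj₂ z≡x) = inj₂ (eqF⇒≡ z≡x)

  special⇒special? : ∀ {z} → Special z → T (special? z)
  special⇒special? {z} (S-or-x , z≢v , P) = T-∧⁺ (S-or-x? S-or-x) (T-∧⁺ (T-not⁺ (λ e → z≢v (eqF⇒≡ e))) (Path⇒reach P))
    where
    S-or-x? : T (S z) ⊎ z ≡ x → T (S z ∨ eqF z x)
    S-or-x? (inj₁ z∈S) = T-∨⁺ˡ z∈S
    S-or-x? (inj₂ refl) = T-∨⁺ʳ {S z} (eqF-refl z)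

  special-dec : (Σ (Fin n) Special) ⊎ (∀ z → ¬ Special z)
  special-dec with any? (λ z → T? (special? z))
  ... | yes (z , h) = inj₁ (z , special?⇒ h)
  ... | no ¬h = inj₂ (λ z sp → ¬h (z , special⇒special? sp))

  XSide : Fin n → Set
  XSide q = q ≡ x ⊎ T (F x q)

  x-side-path : ∀ {q} → XSide q → q ≢ v → Path live∖v F x q
  x-side-path (inj₁ refl) _ = here (without⁺ {ok = live} x-alive x≢v)
  x-side-path {q} (inj₂ e) q≢v =
    path-edge (without⁺ {ok = live} x-alive x≢v) e (without⁺ {ok = live} (proj₂ (adjG'-within s x q e)) q≢v)

  x-side-ID : ∀ {q} → XSide q → ID s q ≡ ID s x
  x-side-ID (inj₁ refl) = refl
  x-side-ID (inj₂ e) = nbr-ID e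

  special-cases : ∀ {z} → Special z → T (UN z) ⊎ XSide z
  special-cases (inj₂ z≡x , _) = inj₂ (inj₁ z≡x)
  special-cases (inj₁ z∈S , _) with S⇒UN⊎nbr z∈S
  ... | inj₁ z∈UN = inj₁ z∈UN
  ... | inj₂ x-z = inj₂ (inj₂ x-z)

  special-ID : ∀ {z} → Special z → ID s v ≡ ID s z
  special-ID (_ , _ , P) = ID-const _ _ P

  -- Special vertices share the ID of v: so at most one lies in UN, and then x's side (of x's
  -- ID) has none; otherwise all of them hang at x.
  special-connected : ∀ {p q} → Special p → Special q → Path live∖v F p q
  special-connected {p} {q} sp sq with special-cases sp | special-cases sq
  ... | inj₂ xp | inj₂ xq = path-trans (path-sym F-sym (x-side-path xp (proj₁ (proj₂ sp)))) (x-side-path xq (proj₁ (proj₂ sq)))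
  ... | inj₁ up | inj₂ xq = ⊥-elim (UN-ID-≢ up (trans (sym (special-ID sp)) (trans (special-ID sq) (x-side-ID xq))))
  ... | inj₂ xp | inj₁ uq = ⊥-elim (UN-ID-≢ uq (trans (sym (special-ID sq)) (trans (special-ID sp) (x-side-ID xp))))
  ... | inj₁ up | inj₁ uq with UN-unique up uq (trans (sym (special-ID sp)) (special-ID sq))
  ... | refl = here (without⁺ {ok = live} (target-ok (proj₂ (proj₂ sp))) (proj₁ (proj₂ sp)))

  weight-move : (P Q : Fin n → Bool) → (∀ {z} → T (P z) → Path live F v z) →
                (∀ y → T (F x y) → y ≢ x → T (P x) → T (Q y)) →
                (Σ (Fin n) λ y → y ≢ x × (T (P x) → T (Q y)) × (∀ z → w s' z ≡ (if eqF z y then w s z + w s x else w s z)))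
                ⊎ (¬ T (P x) × (∀ z → w s' z ≡ w s z))
  weight-move P Q P⇒v⇝ x-y⇒ with w-new
  ... | inj₁ (y , x-y , w′≡) = inj₁ (y , y≢x , x-y⇒ y x-y y≢x , w′≡)
    where
    y≢x : y ≢ x
    y≢x refl = subst T (heal-irrefl x) (adjG'⇒heal s x-y)
  ... | inj₂ (isolated , w′≡w) = inj₂ ((λ Px → no-edge-into-x (last-edge (P⇒v⇝ Px) v≢x)) , w′≡w)
    where
    no-edge-into-x : (Σ (Fin n) λ y → T (F y x)) → ⊥
    no-edge-into-x (y , y-x) = subst T (isolated y) (F-sym y x y-x)

  W-C W-C′ : ℕ
  W-C = componentWeight live F (w s) v
  W-C′ = componentWeight live′ F′ (w s') v

  W-T W-T′ W-R W-R′ : Fin n → ℕ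
  W-T = branchWeight live F (w s) v
  W-T′ = branchWeight live′ F′ (w s') v
  W-R = restWeight live F (w s) v
  W-R′ = restWeight live′ F′ (w s') v

  branchWeights branchWeights′ : List ℕ
  branchWeights = map W-T (filterᵇ (F v) (allFin n))
  branchWeights′ = map W-T′ (filterᵇ (F′ v) (allFin n))

  M : ℕ
  M = maximum branchWeights

  inC inC′ : Fin n → Bool
  inC z = reach live F v z
  inC′ z = reach live′ F′ v z

  inT inT′ : Fin n → Fin n → Bool
  inT u z = reach live∖v F u z
  inT′ u z = reach live′∖v F′ u z

  inC∖T⇒ : ∀ {u z} → T (inC z ∧ not (inT u z)) → Path live F v z × ¬ Path live∖v F u z
  inC∖T⇒ {u} {z} h = reach⇒Path (T-∧⁻ˡ h) , (λ P → T-not⁻ (T-∧⁻ʳ {inC z} h) (Path⇒reach P))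

  inC′∖T′⁺ : ∀ {u z} → Path live′ F′ v z → ¬ Path live′∖v F′ u z → T (inC′ z ∧ not (inT′ u z))
  inC′∖T′⁺ P ¬P = T-∧⁺ (Path⇒reach P) (T-not⁺ (λ r → ¬P (reach⇒Path r)))

  W-C-mono : W-C ≤ W-C′
  W-C-mono = weight-transfer-≤ inC inC′ (w s) (w s') x (λ z z≢x h → Path⇒reach (path-survives (reach⇒Path h) z≢x))
               (weight-move inC inC′ reach⇒Path
                  (λ y x-y y≢x x∈C → Path⇒reach (path-survives (step (reach⇒Path x∈C) x-y (proj₂ (adjG'-within s x y x-y))) y≢x)))

  via-old-branch : ∀ u u′ → T (F v u) → T (F′ v u′) → W-R u ≤ W-R′ u′ → W-C + W-T′ u′ ≤ W-C′ + M
  via-old-branch u u′ v-u v-u′ R≤R′ = begin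
      W-C + W-T′ u′               ≡⟨ cong (_+ W-T′ u′) (component-split live F (w s) v-live v-u) ⟩
      (W-T u + W-R u) + W-T′ u′   ≤⟨ +-monoˡ-≤ (W-T′ u′) (+-mono-≤ (maximum-≥ (∈-map⁺ W-T u∈nbrs)) R≤R′) ⟩
      (M + W-R′ u′) + W-T′ u′     ≡⟨ +-swap-outer M (W-R′ u′) (W-T′ u′) ⟩
      (W-T′ u′ + W-R′ u′) + M     ≡⟨ cong (_+ M) (sym (component-split live′ F′ (w s') v-live′ v-u′)) ⟩
      W-C′ + M ∎
    where
    open ≤-Reasoning
    u∈nbrs : u ∈ filterᵇ (F v) (allFin n)
    u∈nbrs = ∈-filter⁺ (T? ∘ F v) (∈-allFin u) v-u

  via-component : ∀ u′ → T (F′ v u′) → W-C ≤ W-R′ u′ → W-C + W-T′ u′ ≤ W-C′ + M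
  via-component u′ v-u′ C≤R′ = begin
      W-C + W-T′ u′       ≤⟨ +-monoˡ-≤ (W-T′ u′) C≤R′ ⟩
      W-R′ u′ + W-T′ u′   ≡⟨ +-comm (W-R′ u′) (W-T′ u′) ⟩
      W-T′ u′ + W-R′ u′   ≡⟨ sym (component-split live′ F′ (w s') v-live′ v-u′) ⟩
      W-C′                ≤⟨ m≤m+n W-C′ M ⟩
      W-C′ + M ∎
    where open ≤-Reasoning

  AvoidsSpecial : Fin n → Set
  AvoidsSpecial u = ∀ q → Special q → ¬ Path live∖v F u q

  rest-mono-avoiding : ∀ u → T (F v u) → AvoidsSpecial u → W-R u ≤ W-R′ u
  rest-mono-avoiding u v-u avoids =
    weight-transfer-≤ (λ z → inC z ∧ not (inT u z)) (λ z → inC′ z ∧ not (inT′ u z)) (w s) (w s') x C∖T⊆C′∖T′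
                      (weight-move _ _ (λ h → proj₁ (inC∖T⇒ h)) x-y⇒)
    where
    new⇒old : ∀ {z} → Path live′∖v F′ u z → Path live∖v F u z
    new⇒old P with new-path-split P
    ... | inj₁ Q = Q
    ... | inj₂ ((a , a∈S , u⇝a) , _) =
      ⊥-elim (avoids a (inj₁ a∈S , without-≢ {ok = live} (target-ok u⇝a) , branch⇒path live F (w s) v-live v-u u⇝a) u⇝a)
    C∖T⊆C′∖T′ : ∀ z → z ≢ x → T (inC z ∧ not (inT u z)) → T (inC′ z ∧ not (inT′ u z))
    C∖T⊆C′∖T′ z z≢x h with inC∖T⇒ {u} {z} h
    ... | v⇝z , ¬u⇝z = inC′∖T′⁺ (path-survives v⇝z z≢x) (λ P → ¬u⇝z (new⇒old P))
    x-y⇒ : ∀ y → T (F x y) → y ≢ x → T (inC x ∧ not (inT u x)) → T (inC′ y ∧ not (inT′ u y))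
    x-y⇒ y x-y y≢x h with inC∖T⇒ {u} {x} h
    ... | v⇝x , _ = inC′∖T′⁺ (path-survives v⇝y y≢x) ¬u⇝y
      where
      v⇝y : Path live F v y
      v⇝y = step v⇝x x-y (proj₂ (adjG'-within s x y x-y))
      ¬u⇝y : ¬ Path live′∖v F′ u y
      ¬u⇝y P with y ≟ v
      ... | yes refl = without-≢ {ok = live′} (target-ok P) refl
      ... | no y≢v = avoids y (inj₁ (nbr⇒S x-y) , y≢v , v⇝y) (new⇒old P)

  module _ (u* : Fin n) (v-u* : T (F v u*)) (special-in-u* : ∀ {q} → Special q → Path live∖v F u* q) where

    rest-mono-special : ∀ u′ → (u′ ≡ u* ⊎ T (S u′)) → W-R u* ≤ W-R′ u′
    rest-mono-special u′ u′-cases =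
      weight-transfer-≤ (λ z → inC z ∧ not (inT u* z)) (λ z → inC′ z ∧ not (inT′ u′ z)) (w s) (w s') x C∖T⊆C′∖T′
                        (weight-move _ _ (λ h → proj₁ (inC∖T⇒ h)) x-y⇒)
      where
      C∖T⊆C′∖T′ : ∀ z → z ≢ x → T (inC z ∧ not (inT u* z)) → T (inC′ z ∧ not (inT′ u′ z))
      C∖T⊆C′∖T′ z z≢x h with inC∖T⇒ {u*} {z} h
      ... | v⇝z , ¬u*⇝z = inC′∖T′⁺ (path-survives v⇝z z≢x) (¬u′⇝z u′-cases)
        where
        ¬u′⇝z : u′ ≡ u* ⊎ T (S u′) → ¬ Path live′∖v F′ u′ z
        ¬u′⇝z cases P with new-path-split P | cases
        ... | inj₁ Q | inj₁ refl = ¬u*⇝z Q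
        ... | inj₁ Q | inj₂ u′∈S =
          ¬u*⇝z (path-trans (special-in-u* (inj₁ u′∈S , without-≢ {ok = live} (source-ok Q) ,
                                               path-trans v⇝z (path-sym F-sym (path-unwithout {ok = live} {v = v} Q)))) Q)
        ... | inj₂ (_ , (a , a∈S , z⇝a)) | _ =
          ¬u*⇝z (path-trans (special-in-u* (inj₁ a∈S , without-≢ {ok = live} (target-ok z⇝a) ,
                                               path-trans v⇝z (path-unwithout {ok = live} {v = v} z⇝a))) (path-sym F-sym z⇝a))
      x-y⇒ : ∀ y → T (F x y) → y ≢ x → T (inC x ∧ not (inT u* x)) → T (inC′ y ∧ not (inT′ u′ y))
      x-y⇒ y x-y y≢x h with inC∖T⇒ {u*} {x} h
      ... | v⇝x , ¬u*⇝x = ⊥-elim (¬u*⇝x (special-in-u* (inj₂ refl , x≢v , v⇝x)))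

  component≤rest : (∀ z → ¬ Special z) → ∀ u′ → T (S u′) → W-C ≤ W-R′ u′
  component≤rest no-special u′ u′∈S =
    weight-transfer-≤ inC (λ z → inC′ z ∧ not (inT′ u′ z)) (w s) (w s') x C⊆C′∖T′ (weight-move _ _ reach⇒Path x-y⇒)
    where
    C⊆C′∖T′ : ∀ z → z ≢ x → T (inC z) → T (inC′ z ∧ not (inT′ u′ z))
    C⊆C′∖T′ z z≢x h = inC′∖T′⁺ (path-survives v⇝z z≢x) ¬u′⇝z
      where
      v⇝z : Path live F v z
      v⇝z = reach⇒Path h
      ¬u′⇝z : ¬ Path live′∖v F′ u′ z
      ¬u′⇝z P with new-path-split P
      ... | inj₁ Q = no-special u′ (inj₁ u′∈S , without-≢ {ok = live} (source-ok Q) ,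
                                    path-trans v⇝z (path-sym F-sym (path-unwithout {ok = live} {v = v} Q)))
      ... | inj₂ (_ , (a , a∈S , z⇝a)) = no-special a (inj₁ a∈S , without-≢ {ok = live} (target-ok z⇝a) ,
                                                       path-trans v⇝z (path-unwithout {ok = live} {v = v} z⇝a))
    x-y⇒ : ∀ y → T (F x y) → y ≢ x → T (inC x) → T (inC′ y ∧ not (inT′ u′ y))
    x-y⇒ y x-y y≢x x∈C = ⊥-elim (no-special x (inj₂ refl , x≢v , reach⇒Path x∈C))

  new-nbr⇒S : ∀ u′ → T (F′ v u′) → ¬ T (F v u′) → T (S u′)
  new-nbr⇒S u′ v-u′ ¬v-u′ with F′-edge-cases v u′ v-u′
  ... | inj₁ old = ⊥-elim (¬v-u′ old)
  ... | inj₂ (_ , u′∈S) = u′∈S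

  new-branch-bound : ∀ u′ → T (F′ v u′) → W-C + W-T′ u′ ≤ W-C′ + M
  new-branch-bound u′ v-u′ with special-dec
  new-branch-bound u′ v-u′ | inj₂ no-special with T? (F v u′)
  ... | yes v-u′-old = via-old-branch u′ u′ v-u′-old v-u′ (rest-mono-avoiding u′ v-u′-old (λ q sq _ → no-special q sq))
  ... | no ¬v-u′-old = via-component u′ v-u′ (component≤rest no-special u′ (new-nbr⇒S u′ v-u′ ¬v-u′-old))
  new-branch-bound u′ v-u′ | inj₁ (p , p-special)
    with path-enters-branch live F (w s) (proj₁ (proj₂ p-special)) (proj₂ (proj₂ p-special))
  ... | u* , v-u* , u*⇝p = by-cases (T? (F v u′)) (u′ ≟ u*)
    where
    special-in-u* : ∀ {q} → Special q → Path live∖v F u* q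
    special-in-u* q-special = path-trans u*⇝p (special-connected p-special q-special)
    by-cases : Dec (T (F v u′)) → Dec (u′ ≡ u*) → W-C + W-T′ u′ ≤ W-C′ + M
    by-cases (yes v-u′-old) (no u′≢u*) = via-old-branch u′ u′ v-u′-old v-u′ (rest-mono-avoiding u′ v-u′-old avoids)
      where
      avoids : AvoidsSpecial u′
      avoids q q-special u′⇝q = u′≢u* (branch-unique live F (w s) forest F-sym v-u′-old v-u* u′⇝q (special-in-u* q-special))
    by-cases (yes _) (yes u′≡u*) =
      via-old-branch u* u′ v-u* v-u′ (rest-mono-special u* v-u* special-in-u* u′ (inj₁ u′≡u*))
    by-cases (no ¬v-u′-old) _ =
      via-old-branch u* u′ v-u* v-u′ (rest-mono-special u* v-u* special-in-u* u′ (inj₂ (new-nbr⇒S u′ v-u′ ¬v-u′-old)))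

  rem-mono : rem s v ≤ rem s' v
  rem-mono = cross-≤⇒∸-≤ (sum branchWeights) M (w s v) (sum branchWeights′) (maximum branchWeights′) (w s' v)
                         (maximum-≤-sum branchWeights) (maximum-≤-sum branchWeights′) cross
    where
    bound : ∀ {y} → y ∈ branchWeights′ → W-C + y ≤ W-C′ + M
    bound y∈ with ∈-map⁻ W-T′ y∈
    ... | u′ , u′∈nbrs , refl = new-branch-bound u′ (proj₂ (∈-filter⁻ (T? ∘ F′ v) {xs = allFin n} u′∈nbrs))
    cross : (sum branchWeights + w s v) + maximum branchWeights′ ≤ (sum branchWeights′ + w s' v) + M
    cross = subst₂ (λ a b → a + maximum branchWeights′ ≤ b + M)
              (sym (branch-weights-sum live F (w s) F-sym forest v-live))
              (sym (branch-weights-sum live′ F′ (w s') (adjG'-sym invariant′) forest′ v-live′))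
              (+-maximum-≤ W-C (W-C′ + M) branchWeights′ bound (≤-trans W-C-mono (m≤m+n W-C′ M)))

lemma2 : ∀ {n} (E₀ : Graph n) (id₀ : Fin n → ℕ)
         → SimpleGraph E₀ → Connected E₀
         → (∀ u v → id₀ u ≡ id₀ v → u ≡ v)
         → ∀ {s s' : State n} (x : Fin n)
         → Run E₀ id₀ s → Step E₀ id₀ x s s'
         → ∀ v → T (alive s' v) → rem s v ≤ rem s' v
lemma2 E₀ id₀ _ _ inj x run st v v-live′ =
  RemMonotone.rem-mono E₀ id₀ inj x st (invariant-run E₀ id₀ inj run) v v-live′
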